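{- Let $h$ be a Hessenberg function, $\lambda=(\lambda_1,\lambda_2)$ a composition of $n$ with two positive parts, and $0\le k\le\lambda_2$; if $\lambda_1=1$ assume also $k\ge1$. Then the stabilizer of $f^{(k)}_\lambda$ in $S_n$ under the dot action is exactly $S_\lambda$.
   Context: $[n]=\{1,\dots,n\}$; a Hessenberg function is a nondecreasing $h:[n]\to[n]$ with $h(i)\ge i$. $S_n$ acts on $\mathbb{C}[t_1,\dots,t_n]$ with $v(t_i)=t_{v(i)}$. Dot action on functions $f:S_n\to\mathbb{C}[t_1,\dots,t_n]$: $(v\cdot f)(w)=v(f(v^{ -1}w))$. Bruhat order is $\le$; $S_\lambda$ is generated by the simple transpositions $s_i$, $i\ne\lambda_1$. ${}^\lambda S_n=\{v:v^{ -1}(1)<\dots<v^{ -1}(\lambda_1),\ v^{ -1}(\lambda_1+1)<\dots<v^{ -1}(n)\}$; each $w$ is uniquely $yv$ with $y\in S_\lambda$, $v\in{}^\lambda S_n$. For $0\le j\le\lambda_2$, $v_j$ has one-line notation $[\lambda_1+1,\dots,\lambda_1+j,1,\lambda_1+j+1,\dots,n,2,\dots,\lambda_1]$. $\mathcal S_k=\{t_a-t_b:a<b,\ v_k^{ -1}(a)>v_k^{ -1}(b),\ v_k^{ -1}(a)\le h(v_k^{ -1}(b))\}$, and $f^{(k)}_\lambda(yv)=\prod_{t_a-t_b\in\mathcal S_k}(t_{y(a)}-t_{y(b)})$ if $v\ge v_k$, $0$ otherwise. -}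

module Defs where

open import Data.Nat as ℕ using (ℕ; zero; suc; _+_; _∸_)
import Data.Nat.Properties as ℕP
open import Data.Fin as F using (Fin; toℕ; fromℕ<)
open import Data.Fin.Properties as FP using ()
open import Data.Fin.Permutation using (Permutation′; _⟨$⟩ʳ_; _⟨$⟩ˡ_; transpose)
open import Data.Integer as ℤ using (ℤ; +_; -[1+_])
open import Data.Vec as V using (Vec; lookup; tabulate; replicate; zipWith)
open import Data.Vec.Properties using (≡-dec)
open import Data.List as L using (List; []; _∷_; map; concatMap; foldr; filter; cartesianProduct; allFin)
open import Data.List.Relation.Unary.All using (All)
open import Data.Product using (Σ; ∃; _×_; _,_; proj₁; proj₂)
open import Relation.Binary.PropositionalEquality using (_≡_; _≢_)
open import Relation.Nullary using (¬_; yes; no; does)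
open import Relation.Nullary.Decidable using (_×-dec_)
open import Data.Bool using (if_then_else_)
open import Function using (_∘_; id)
open import Data.Sum using (_⊎_)

-- Conventions: [n] = {1,…,n} is modelled by Fin n = {0,…,n-1}
-- (everything shifted down by one).  λ = (λ₁ , λ₂) = (p , q), n = p + q.

IsHessenberg : ∀ {n} → (Fin n → Fin n) → Set
IsHessenberg {n} h = (∀ (i j : Fin n) → i F.≤ j → h i F.≤ h j) × (∀ (i : Fin n) → i F.≤ h i)

-- Polynomials in t₀,…,t_{n-1} with integer coefficients, as formal
-- finite sums of terms  c · t^e  (e an exponent vector), with equality
-- meaning equality of all coefficients.

Mon : ℕ → Set
Mon n = Vec ℕ n

Poly : ℕ → Set
Poly n = List (ℤ × Mon n)

coeff : ∀ {n} → Poly n → Mon n → ℤ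
coeff [] m = + 0
coeff ((c , e) ∷ P) m = (if does (≡-dec ℕP._≟_ e m) then c else + 0) ℤ.+ coeff P m

infix 4 _≈P_
_≈P_ : ∀ {n} → Poly n → Poly n → Set
P ≈P Q = ∀ m → coeff P m ≡ coeff Q m

zeroP : ∀ {n} → Poly n
zeroP = []

oneP : ∀ {n} → Poly n
oneP = (+ 1 , replicate _ 0) ∷ []

_*P_ : ∀ {n} → Poly n → Poly n → Poly n
P *P Q = concatMap (λ { (c , e) → map (λ { (d , f) → (c ℤ.* d , zipWith _+_ e f) }) Q }) P

unitMon : ∀ {n} → Fin n → Mon n
unitMon a = tabulate (λ i → if does (i FP.≟ a) then 1 else 0)

linP : ∀ {n} → Fin n → Fin n → Poly n
linP a b = (+ 1 , unitMon a) ∷ (-[1+ 0 ] , unitMon b) ∷ []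

-- action of σ ∈ S_n on polynomials: σ(t_i) = t_{σ(i)}.
-- The exponent of t_j in σ(t^e) is e_{σ⁻¹(j)}.
actP : ∀ {n} → Permutation′ n → Poly n → Poly n
actP σ = map (λ { (c , e) → (c , tabulate (λ j → lookup e (σ ⟨$⟩ˡ j))) })

-- Permutations viewed as functions; composition (yv)(x) = y(v(x)).

-- Bruhat order on S_n (as functions, up to pointwise equality):
-- reflexive–transitive closure of u < u∘t_{ij} for i < j with u(i) < u(j).
data _≤B_ {n} (u : Fin n → Fin n) : (Fin n → Fin n) → Set where
  ≤B-refl : ∀ {w} → (∀ x → u x ≡ w x) → u ≤B w
  ≤B-step : ∀ {w′ w} → u ≤B w′ → (i j : Fin n) → i F.< j → w′ i F.< w′ j →
            (∀ x → w x ≡ w′ (transpose i j ⟨$⟩ʳ x)) → u ≤B w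

-- S_λ: the subgroup generated by the simple transpositions s_i, i ≠ λ₁.
-- In 0-based indexing s_i swaps a = i-1 and b = i, so the allowed
-- generators are adjacent pairs (a , b), toℕ b = toℕ a + 1, with toℕ b ≢ p.
AllowedGen : ∀ {n} → ℕ → Fin n × Fin n → Set
AllowedGen p (a , b) = (toℕ b ≡ suc (toℕ a)) × (toℕ b ≢ p)

wordPerm : ∀ {n} → List (Fin n × Fin n) → Fin n → Fin n
wordPerm [] = id
wordPerm ((a , b) ∷ ws) = (transpose a b ⟨$⟩ʳ_) ∘ wordPerm ws

InSλ : ∀ {n} → ℕ → (Fin n → Fin n) → Set
InSλ {n} p y = Σ (List (Fin n × Fin n)) λ ws → All (AllowedGen p) ws × (∀ x → y x ≡ wordPerm ws x)

-- ^λS_n : v⁻¹ is increasing on {1..λ₁} and on {λ₁+1..n}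
-- (a < b in the same block, i.e. b < p or a ≥ p, implies v⁻¹ a < v⁻¹ b).
MinRep : ∀ {n} → ℕ → Permutation′ n → Set
MinRep {n} p v = ∀ (a b : Fin n) → a F.< b →
  (toℕ b ℕ.< p ⊎ p ℕ.≤ toℕ a) → (v ⟨$⟩ˡ a) F.< (v ⟨$⟩ˡ b)

-- v_k, 0-based: one-line [λ₁+1,…,λ₁+k,1,λ₁+k+1,…,n,2,…,λ₁] becomes
--   x < k      ↦ p + x
--   x = k      ↦ 0
--   k < x ≤ q  ↦ p + x - 1
--   q < x      ↦ x - q
vkℕ : ℕ → ℕ → ℕ → ℕ → ℕ
vkℕ p q k x with x ℕ.<? k | x ℕ.≟ k | x ℕ.≤? q
... | yes _ | _     | _     = p + x
... | no _  | yes _ | _     = 0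
... | no _  | no _  | yes _ = p + x ∸ 1
... | no _  | no _  | no _  = x ∸ q

-- ℕ → Fin n with a default (never used: vkℕ maps [0,n) into [0,n))
clampFin : ∀ {n} → Fin n → ℕ → Fin n
clampFin {n} d m with m ℕ.<? n
... | yes m<n = fromℕ< m<n
... | no _    = d

vk : (p q k : ℕ) → Fin (p + q) → Fin (p + q)
vk p q k x = clampFin x (vkℕ p q k (toℕ x))

-- 𝒮_k = { t_a - t_b : a < b, v_k⁻¹(a) > v_k⁻¹(b), v_k⁻¹(a) ≤ h(v_k⁻¹(b)) },
-- indexed by (i , j) = (v_k⁻¹ a , v_k⁻¹ b), i.e. a = v_k(i), b = v_k(j):
-- the pairs with v_k(i) < v_k(j), j < i, i ≤ h(j).
SkIdx : (p q k : ℕ) → (Fin (p + q) → Fin (p + q)) → List (Fin (p + q) × Fin (p + q))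
SkIdx p q k h = filter (λ { (i , j) → (vk p q k i F.<? vk p q k j) ×-dec ((j F.<? i) ×-dec (i F.≤? h j)) })
                       (cartesianProduct (allFin _) (allFin _))

prodSk : (p q k : ℕ) → (Fin (p + q) → Fin (p + q)) → (Fin (p + q) → Fin (p + q)) → Poly (p + q)
prodSk p q k h y = foldr (λ { (i , j) acc → linP (y (vk p q k i)) (y (vk p q k j)) *P acc }) oneP (SkIdx p q k h)

-- "f^{(k)}_λ(w) = P": for the (unique) factorisation w = y v, y ∈ S_λ,
-- v ∈ ^λS_n, P is the product over 𝒮_k if v ≥ v_k and 0 otherwise.
fkVal : (p q k : ℕ) → (Fin (p + q) → Fin (p + q)) → (Fin (p + q) → Fin (p + q)) → Poly (p + q) → Set
fkVal p q k h w P =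
  ∀ (y v : Permutation′ (p + q)) → InSλ p (y ⟨$⟩ʳ_) → MinRep p v →
  (∀ x → w x ≡ y ⟨$⟩ʳ (v ⟨$⟩ʳ x)) →
  (vk p q k ≤B (v ⟨$⟩ʳ_) → P ≈P prodSk p q k h (y ⟨$⟩ʳ_)) ×
  (¬ (vk p q k ≤B (v ⟨$⟩ʳ_)) → P ≈P zeroP)

-- σ stabilises f^{(k)}_λ under the dot action: (σ·f)(w) = σ(f(σ⁻¹w)) = f(w) for all w.
StabFk : (p q k : ℕ) → (Fin (p + q) → Fin (p + q)) → Permutation′ (p + q) → Set
StabFk p q k h σ =
  ∀ (w : Permutation′ (p + q)) (P Q : Poly (p + q)) →
  fkVal p q k h (λ x → σ ⟨$⟩ˡ (w ⟨$⟩ʳ x)) P → fkVal p q k h (w ⟨$⟩ʳ_) Q →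
  actP σ P ≈P Q

module Submission where

open import Defs
open import Data.Nat using (ℕ; _+_; _≤_)
open import Data.Fin using (Fin)
open import Data.Fin.Permutation using (Permutation′; _⟨$⟩ʳ_)
open import Relation.Binary.PropositionalEquality using (_≡_)
open import Function.Bundles using (_⇔_)

open import Data.Nat using (zero; suc; _∸_; _*_; _<_; z≤n; s≤s; _≟_; _<?_; _≤?_)
import Data.Nat.Properties as ℕP
open import Data.Fin as F using (toℕ; fromℕ<)
import Data.Fin.Properties as FP
open import Data.Fin.Permutation as Perm using (_⟨$⟩ˡ_; transpose; _∘ₚ_; flip; inverseˡ; inverseʳ)
import Data.Fin.Permutation.Components as PC
open import Data.Integer as ℤ using (ℤ; +_; -[1+_])
import Data.Integer.Properties as ℤP
import Data.Integer.Tactic.RingSolver as ℤSolver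
open import Data.Vec using (Vec; lookup; tabulate; replicate; zipWith)
import Data.Vec.Properties as VP
open import Data.List as L using (List; []; _∷_; _++_; map; concatMap; foldr; filter; cartesianProduct; allFin)
import Data.List.Properties as LP
open import Data.List.Relation.Unary.All as All using (All; []; _∷_)
import Data.List.Relation.Unary.All.Properties as AllP
open import Data.Product using (Σ; ∃; _×_; _,_; proj₁; proj₂)
open import Data.Sum using (_⊎_; inj₁; inj₂)
open import Data.Empty using (⊥; ⊥-elim)
open import Data.Bool using (if_then_else_)
open import Relation.Binary.Definitions using (tri<; tri≈; tri>)
open import Relation.Binary.PropositionalEquality using (_≢_; refl; sym; trans; cong; cong₂; subst; subst₂; module ≡-Reasoning)
open import Relation.Nullary using (¬_; yes; no; does; Dec)
open import Relation.Nullary.Decidable using (_×-dec_; ¬?; decidable-stable; does-⇔)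
open import Function using (_∘_; id)
open import Function.Bundles using (mk⇔)
import Data.Nat.Tactic.RingSolver as ℕSolver

-- An element σ of S_λ turns the factorisation w = y v into
-- σ⁻¹ w = (σ⁻¹ y) v and permutes the linear factors of the product, so it
-- fixes f.  Conversely, if σ moves some i from the first block to the second,
-- pick a transposition π inside a block so that σ π v_k breaks a pattern
-- shared by all y v with v ≥ v_k (v_k sends its first k positions into the
-- second block and its last λ₁ - 1 positions into the first).  Then
-- f(σ π v_k) = 0 while f(π v_k) is a product of distinct linear forms,
-- which is nonzero, so σ is no stabiliser.  A permutation preserving both
-- blocks lies in S_λ: bubble sort writes it as a word in the s_i, i ≠ λ₁.

permutation-injective : ∀ {n} (σ : Permutation′ n) {x y} → σ ⟨$⟩ʳ x ≡ σ ⟨$⟩ʳ y → x ≡ y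
permutation-injective σ {x} {y} e = trans (sym (inverseˡ σ)) (trans (cong (σ ⟨$⟩ˡ_) e) (inverseˡ σ))

transpose-matchˡ : ∀ {n} (i j k : Fin n) → k ≡ i → PC.transpose i j k ≡ j
transpose-matchˡ i j k e with k FP.≟ i
... | yes _ = refl
... | no k≢i = ⊥-elim (k≢i e)

transpose-matchʳ : ∀ {n} (i j k : Fin n) → k ≢ i → k ≡ j → PC.transpose i j k ≡ i
transpose-matchʳ i j k k≢i e with k FP.≟ i
... | yes k≡i = ⊥-elim (k≢i k≡i)
... | no _ with k FP.≟ j
...   | yes _ = refl
...   | no k≢j = ⊥-elim (k≢j e)

transpose-other : ∀ {n} (i j k : Fin n) → k ≢ i → k ≢ j → PC.transpose i j k ≡ k
transpose-other i j k k≢i k≢j with k FP.≟ i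
... | yes k≡i = ⊥-elim (k≢i k≡i)
... | no _ with k FP.≟ j
...   | yes k≡j = ⊥-elim (k≢j k≡j)
...   | no _ = refl

data TransposeView {n} (i j k : Fin n) : Set where
  at-i  : k ≡ i → PC.transpose i j k ≡ j → TransposeView i j k
  at-j  : k ≡ j → PC.transpose i j k ≡ i → TransposeView i j k
  other : PC.transpose i j k ≡ k → TransposeView i j k

transposeView : ∀ {n} (i j k : Fin n) → TransposeView i j k
transposeView i j k with k FP.≟ i
... | yes k≡i = at-i k≡i (transpose-matchˡ i j k k≡i)
... | no k≢i with k FP.≟ j
...   | yes k≡j = at-j k≡j (transpose-matchʳ i j k k≢i k≡j)
...   | no k≢j = other (transpose-other i j k k≢i k≢j)

PreservesBlocks : ∀ {n} → ℕ → (Fin n → Fin n) → Set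
PreservesBlocks p f = ∀ x → (toℕ x < p → toℕ (f x) < p) × (p ≤ toℕ x → p ≤ toℕ (f x))

SameBlock : ∀ {n} → ℕ → Fin n → Fin n → Set
SameBlock p a b = toℕ b < p ⊎ p ≤ toℕ a

IncreasingOnBlocks : ∀ {n} → ℕ → (Fin n → Fin n) → Set
IncreasingOnBlocks {n} p g = ∀ (a b : Fin n) → a F.< b → SameBlock p a b → g a F.< g b

preservesBlocks-∘ : ∀ {n p} {f g : Fin n → Fin n} → PreservesBlocks p f → PreservesBlocks p g → PreservesBlocks p (f ∘ g)
preservesBlocks-∘ bf bg x = proj₁ (bf _) ∘ proj₁ (bg x) , proj₂ (bf _) ∘ proj₂ (bg x)

preservesBlocks-resp-≗ : ∀ {n p} {f g : Fin n → Fin n} → (∀ x → f x ≡ g x) → PreservesBlocks p f → PreservesBlocks p g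
preservesBlocks-resp-≗ eq bf x rewrite sym (eq x) = bf x

preservesBlocks-inverse : ∀ {n p} (σ : Permutation′ n) → PreservesBlocks p (σ ⟨$⟩ʳ_) → PreservesBlocks p (σ ⟨$⟩ˡ_)
preservesBlocks-inverse {n} {p} σ b x = lower , upper
  where
  lower : toℕ x < p → toℕ (σ ⟨$⟩ˡ x) < p
  lower x<p with ℕP.<-≤-connex (toℕ (σ ⟨$⟩ˡ x)) p
  ... | inj₁ r = r
  ... | inj₂ p≤ = ⊥-elim (ℕP.<⇒≱ x<p (subst (λ z → p ≤ toℕ z) (inverseʳ σ) (proj₂ (b _) p≤)))
  upper : p ≤ toℕ x → p ≤ toℕ (σ ⟨$⟩ˡ x)
  upper p≤x with ℕP.<-≤-connex (toℕ (σ ⟨$⟩ˡ x)) p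
  ... | inj₂ r = r
  ... | inj₁ <p = ⊥-elim (ℕP.<⇒≱ (subst (λ z → toℕ z < p) (inverseʳ σ) (proj₁ (b _) <p)) p≤x)

InOneBlock : ∀ {n} → ℕ → Fin n → Fin n → Set
InOneBlock p a b = (toℕ a < p × toℕ b < p) ⊎ (p ≤ toℕ a × p ≤ toℕ b)

inOneBlock-sym : ∀ {n p} {a b : Fin n} → InOneBlock p a b → InOneBlock p b a
inOneBlock-sym (inj₁ (a<p , b<p)) = inj₁ (b<p , a<p)
inOneBlock-sym (inj₂ (p≤a , p≤b)) = inj₂ (p≤b , p≤a)

inOneBlock⇒sameBlockAs : ∀ {n p} {a b : Fin n} → InOneBlock p a b → (toℕ a < p → toℕ b < p) × (p ≤ toℕ a → p ≤ toℕ b)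
inOneBlock⇒sameBlockAs (inj₁ (a<p , b<p)) = (λ _ → b<p) , (λ p≤a → ⊥-elim (ℕP.<⇒≱ a<p p≤a))
inOneBlock⇒sameBlockAs (inj₂ (p≤a , p≤b)) = (λ a<p → ⊥-elim (ℕP.<⇒≱ a<p p≤a)) , (λ _ → p≤b)

transpose-preservesBlocks : ∀ {n p} (a b : Fin n) → InOneBlock p a b → PreservesBlocks p (PC.transpose a b)
transpose-preservesBlocks a b ab x with transposeView a b x
... | at-i refl e rewrite e = inOneBlock⇒sameBlockAs ab
... | at-j refl e rewrite e = inOneBlock⇒sameBlockAs (inOneBlock-sym ab)
... | other e rewrite e = id , id

allowedGen⇒inOneBlock : ∀ {n p} {a b : Fin n} → AllowedGen p (a , b) → InOneBlock p a b
allowedGen⇒inOneBlock {p = p} {a} {b} (b≡1+a , b≢p) with toℕ b <? p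
... | yes b<p = inj₁ (ℕP.<-trans (subst (toℕ a <_) (sym b≡1+a) (ℕP.n<1+n _)) b<p , b<p)
... | no b≮p = inj₂ (ℕP.≤-pred (subst (suc p ≤_) b≡1+a (ℕP.≤∧≢⇒< (ℕP.≮⇒≥ b≮p) (b≢p ∘ sym))) , ℕP.≮⇒≥ b≮p)

wordPerm-preservesBlocks : ∀ {n p} (ws : List (Fin n × Fin n)) → All (AllowedGen p) ws → PreservesBlocks p (wordPerm ws)
wordPerm-preservesBlocks [] [] x = id , id
wordPerm-preservesBlocks ((a , b) ∷ ws) (g ∷ gs) =
  preservesBlocks-∘ (transpose-preservesBlocks a b (allowedGen⇒inOneBlock g)) (wordPerm-preservesBlocks ws gs)

InSλ⇒preservesBlocks : ∀ {n p} {y : Fin n → Fin n} → InSλ p y → PreservesBlocks p y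
InSλ⇒preservesBlocks (ws , gs , eq) = preservesBlocks-resp-≗ (sym ∘ eq) (wordPerm-preservesBlocks ws gs)

wordPermutation : ∀ {n} → List (Fin n × Fin n) → Permutation′ n
wordPermutation [] = Perm.id
wordPermutation ((a , b) ∷ ws) = wordPermutation ws ∘ₚ transpose a b

wordPermutation-correct : ∀ {n} (ws : List (Fin n × Fin n)) x → wordPermutation ws ⟨$⟩ʳ x ≡ wordPerm ws x
wordPermutation-correct [] x = refl
wordPermutation-correct ((a , b) ∷ ws) x = cong (PC.transpose a b) (wordPermutation-correct ws x)

wordPerm-++ : ∀ {n} (ws vs : List (Fin n × Fin n)) x → wordPerm (ws ++ vs) x ≡ wordPerm ws (wordPerm vs x)
wordPerm-++ [] vs x = refl
wordPerm-++ ((a , b) ∷ ws) vs x = cong (PC.transpose a b) (wordPerm-++ ws vs x)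

-- A map increasing on both blocks and preserving them is squeezed to the
-- identity: upwards from 0 and from p, downwards from p - 1 and from n - 1.
module BlockwiseIncreasing {n p : ℕ} {u : Fin n → Fin n}
         (blocks : PreservesBlocks p u) (incr : IncreasingOnBlocks p u) where

  successor-< : ∀ m (m<n : m < n) (1+m<n : suc m < n) → suc m ≢ p →
                toℕ (u (fromℕ< m<n)) < toℕ (u (fromℕ< 1+m<n))
  successor-< m m<n 1+m<n 1+m≢p = incr (fromℕ< m<n) (fromℕ< 1+m<n) m<1+m sameBlock
    where
    m<1+m : fromℕ< m<n F.< fromℕ< 1+m<n
    m<1+m = subst₂ _<_ (sym (FP.toℕ-fromℕ< m<n)) (sym (FP.toℕ-fromℕ< 1+m<n)) (ℕP.n<1+n m)
    sameBlock : SameBlock p (fromℕ< m<n) (fromℕ< 1+m<n)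
    sameBlock with suc m <? p
    ... | yes 1+m<p = inj₁ (subst (_< p) (sym (FP.toℕ-fromℕ< 1+m<n)) 1+m<p)
    ... | no 1+m≮p = inj₂ (subst (p ≤_) (sym (FP.toℕ-fromℕ< m<n))
                             (ℕP.≤-pred (ℕP.≤∧≢⇒< (ℕP.≮⇒≥ 1+m≮p) (1+m≢p ∘ sym))))

  ≤-image : ∀ m (m<n : m < n) → m ≤ toℕ (u (fromℕ< m<n))
  ≤-image zero m<n = z≤n
  ≤-image (suc m) 1+m<n with suc m ≟ p
  ... | yes refl = proj₂ (blocks (fromℕ< 1+m<n)) (ℕP.≤-reflexive (sym (FP.toℕ-fromℕ< 1+m<n)))
  ... | no 1+m≢p = ℕP.≤-<-trans (≤-image m m<n) (successor-< m m<n 1+m<n 1+m≢p)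
    where m<n = ℕP.<-trans (ℕP.n<1+n m) 1+m<n

  image-≤ : ∀ d m (m<n : m < n) → n ≡ suc (m + d) → toℕ (u (fromℕ< m<n)) ≤ m
  image-≤ zero m m<n n≡ =
    ℕP.≤-pred (subst (toℕ (u (fromℕ< m<n)) <_) (trans n≡ (cong suc (ℕP.+-identityʳ m))) (FP.toℕ<n _))
  image-≤ (suc d) m m<n n≡ with suc m ≟ p
  ... | yes refl = ℕP.≤-pred (proj₁ (blocks (fromℕ< m<n)) (subst (_< suc m) (sym (FP.toℕ-fromℕ< m<n)) (ℕP.n<1+n m)))
  ... | no 1+m≢p = ℕP.≤-pred (ℕP.<-≤-trans (successor-< m m<n 1+m<n 1+m≢p) (image-≤ d (suc m) 1+m<n n≡′))
    where
    n≡′ : n ≡ suc (suc m + d)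
    n≡′ = trans n≡ (cong suc (ℕP.+-suc m d))
    1+m<n : suc m < n
    1+m<n = subst (suc m <_) (sym n≡′) (s≤s (s≤s (ℕP.m≤m+n m d)))

  ≗id : ∀ x → u x ≡ x
  ≗id x = FP.toℕ-injective (ℕP.≤-antisym
    (subst (λ z → toℕ (u z) ≤ toℕ x) x≡ (image-≤ (n ∸ suc (toℕ x)) (toℕ x) x<n (sym (ℕP.m+[n∸m]≡n x<n))))
    (subst (λ z → toℕ x ≤ toℕ (u z)) x≡ (≤-image (toℕ x) x<n)))
    where
    x<n = FP.toℕ<n x
    x≡ : fromℕ< x<n ≡ x
    x≡ = FP.fromℕ<-toℕ x x<n

preservesBlocks∧increasingOnBlocks⇒≗id : ∀ {n p} {u : Fin n → Fin n} →
  PreservesBlocks p u → IncreasingOnBlocks p u → ∀ x → u x ≡ x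
preservesBlocks∧increasingOnBlocks⇒≗id blocks incr = BlockwiseIncreasing.≗id blocks incr

∑ : ∀ {n} → (Fin n → ℕ) → ℕ
∑ {zero} f = 0
∑ {suc n} f = f F.zero + ∑ (f ∘ F.suc)

∑-cong : ∀ {n} {f g : Fin n → ℕ} → (∀ i → f i ≡ g i) → ∑ f ≡ ∑ g
∑-cong {zero} eq = refl
∑-cong {suc n} eq = cong₂ _+_ (eq F.zero) (∑-cong (eq ∘ F.suc))

∑-bound : ∀ {n} (f : Fin n → ℕ) B → (∀ i → f i ≤ B) → ∑ f ≤ n * B
∑-bound {zero} f B f≤B = z≤n
∑-bound {suc n} f B f≤B = ℕP.+-mono-≤ (f≤B F.zero) (∑-bound (f ∘ F.suc) B (f≤B ∘ F.suc))

erase : ∀ {n} → Fin n → (Fin n → ℕ) → Fin n → ℕ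
erase a f i = if does (i FP.≟ a) then 0 else f i

erase-other : ∀ {n} (a : Fin n) f i → i ≢ a → erase a f i ≡ f i
erase-other a f i i≢a with i FP.≟ a
... | yes i≡a = ⊥-elim (i≢a i≡a)
... | no _ = refl

∑-erase : ∀ {n} (f : Fin n → ℕ) a → ∑ f ≡ ∑ (erase a f) + f a
∑-erase {suc n} f F.zero = ℕP.+-comm (f F.zero) _
∑-erase {suc n} f (F.suc a) = begin
  f F.zero + ∑ (f ∘ F.suc)                             ≡⟨ cong (_+_ (f F.zero)) (∑-erase (f ∘ F.suc) a) ⟩
  f F.zero + (∑ (erase a (f ∘ F.suc)) + f (F.suc a))   ≡⟨ ℕP.+-assoc (f F.zero) _ _ ⟨
  f F.zero + ∑ (erase a (f ∘ F.suc)) + f (F.suc a)     ∎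
  where open ≡-Reasoning

∑-erase₂ : ∀ {n} (f : Fin n → ℕ) {a b} → a ≢ b → ∑ f ≡ ∑ (erase b (erase a f)) + (f a + f b)
∑-erase₂ f {a} {b} a≢b = begin
  ∑ f                                                  ≡⟨ ∑-erase f a ⟩
  ∑ (erase a f) + f a                                  ≡⟨ cong (_+ f a) (∑-erase (erase a f) b) ⟩
  ∑ (erase b (erase a f)) + erase a f b + f a          ≡⟨ cong (λ z → ∑ (erase b (erase a f)) + z + f a) (erase-other a f b (a≢b ∘ sym)) ⟩
  ∑ (erase b (erase a f)) + f b + f a                  ≡⟨ swap-last _ (f b) (f a) ⟩
  ∑ (erase b (erase a f)) + (f a + f b)                ∎
  where
  open ≡-Reasoning
  swap-last : ∀ x y z → x + y + z ≡ x + (z + y)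
  swap-last = ℕSolver.solve-∀

∑-<-atTwo : ∀ {n} (f g : Fin n → ℕ) {a b} → a ≢ b → (∀ i → i ≢ a → i ≢ b → f i ≡ g i) →
            f a + f b < g a + g b → ∑ f < ∑ g
∑-<-atTwo f g {a} {b} a≢b agree fab<gab = subst₂ _<_ (sym (∑-erase₂ f a≢b)) (sym (∑-erase₂ g a≢b))
  (subst (λ s → ∑ (erase b (erase a f)) + (f a + f b) < s + (g a + g b)) (∑-cong erased) (ℕP.+-monoʳ-< (∑ (erase b (erase a f))) fab<gab))
  where
  erased : ∀ i → erase b (erase a f) i ≡ erase b (erase a g) i
  erased i with i FP.≟ b | i FP.≟ a
  ... | yes _ | _ = refl
  ... | no _ | yes _ = refl
  ... | no i≢b | no i≢a = agree i i≢a i≢b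

sameBlock-shrinkʳ : ∀ {n p} {a b c : Fin n} → toℕ c < toℕ b → SameBlock p a b → SameBlock p a c
sameBlock-shrinkʳ c<b (inj₁ b<p) = inj₁ (ℕP.<-trans c<b b<p)
sameBlock-shrinkʳ c<b (inj₂ p≤a) = inj₂ p≤a

sameBlock-shrinkˡ : ∀ {n p} {a b c : Fin n} → toℕ a ≤ toℕ c → SameBlock p a b → SameBlock p c b
sameBlock-shrinkˡ a≤c (inj₁ b<p) = inj₁ b<p
sameBlock-shrinkˡ a≤c (inj₂ p≤a) = inj₂ (ℕP.≤-trans p≤a a≤c)

sameBlock-adjacent⇒allowed : ∀ {n p} {a b : Fin n} → toℕ b ≡ suc (toℕ a) → SameBlock p a b → AllowedGen p (a , b)
sameBlock-adjacent⇒allowed b≡1+a (inj₁ b<p) = b≡1+a , ℕP.<⇒≢ b<p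
sameBlock-adjacent⇒allowed {a = a} b≡1+a (inj₂ p≤a) =
  b≡1+a , λ b≡p → ℕP.<⇒≱ (subst (toℕ a <_) (trans (sym b≡1+a) b≡p) (ℕP.n<1+n _)) p≤a

-- Bubble sort: append adjacent transpositions s_i, i ≠ λ₁, to a word while
-- w⁻¹ ∘ word has a descent inside a block.  Each step raises the bounded
-- potential ∑ i · (w⁻¹ ∘ word)(i), so the process stops.
module BubbleSort {n : ℕ} (p : ℕ) (w : Permutation′ n) where
  Word : Set
  Word = List (Fin n × Fin n)

  residue : Word → Fin n → Fin n
  residue ws x = w ⟨$⟩ˡ wordPerm ws x

  residue-injective : ∀ ws {x y} → residue ws x ≡ residue ws y → x ≡ y
  residue-injective ws {x} {y} e = permutation-injective (wordPermutation ws) (begin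
    wordPermutation ws ⟨$⟩ʳ x   ≡⟨ wordPermutation-correct ws x ⟩
    wordPerm ws x               ≡⟨ permutation-injective (flip w) e ⟩
    wordPerm ws y               ≡⟨ wordPermutation-correct ws y ⟨
    wordPermutation ws ⟨$⟩ʳ y   ∎)
    where open ≡-Reasoning

  potential : Word → ℕ
  potential ws = ∑ λ i → toℕ i * toℕ (residue ws i)

  potential-bound : ∀ ws → potential ws ≤ n * (n * n)
  potential-bound ws = ∑-bound _ (n * n) λ i →
    ℕP.*-mono-≤ (ℕP.<⇒≤ (FP.toℕ<n i)) (ℕP.<⇒≤ (FP.toℕ<n (residue ws i)))

  Descent : Word → Fin n → Fin n → Set
  Descent ws a b = AllowedGen p (a , b) × toℕ (residue ws b) < toℕ (residue ws a)

  descent? : ∀ ws → Dec (∃ λ a → ∃ λ b → Descent ws a b)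
  descent? ws = FP.any? λ a → FP.any? λ b →
    ((toℕ b ≟ suc (toℕ a)) ×-dec ¬? (toℕ b ≟ p)) ×-dec (toℕ (residue ws b) <? toℕ (residue ws a))

  potential-step : ∀ ws a b → Descent ws a b → potential ws < potential (ws ++ (a , b) ∷ [])
  potential-step ws a b ((b≡1+a , _) , descent) = ∑-<-atTwo f f′ a≢b agree ineq
    where
    f f′ : Fin n → ℕ
    f i = toℕ i * toℕ (residue ws i)
    f′ i = toℕ i * toℕ (residue (ws ++ (a , b) ∷ []) i)
    residue-++ : ∀ i → residue (ws ++ (a , b) ∷ []) i ≡ residue ws (PC.transpose a b i)
    residue-++ i = cong (w ⟨$⟩ˡ_) (wordPerm-++ ws ((a , b) ∷ []) i)
    a≢b : a ≢ b
    a≢b a≡b = ℕP.<⇒≢ (ℕP.n<1+n (toℕ a)) (trans (cong toℕ a≡b) b≡1+a)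
    agree : ∀ i → i ≢ a → i ≢ b → f i ≡ f′ i
    agree i i≢a i≢b = cong (λ z → toℕ i * toℕ z)
      (sym (trans (residue-++ i) (cong (residue ws) (transpose-other a b i i≢a i≢b))))
    f′a : f′ a ≡ toℕ a * toℕ (residue ws b)
    f′a = cong (λ z → toℕ a * toℕ z) (trans (residue-++ a) (cong (residue ws) (transpose-matchˡ a b a refl)))
    f′b : f′ b ≡ suc (toℕ a) * toℕ (residue ws a)
    f′b = trans (cong (λ z → toℕ b * toℕ z) (trans (residue-++ b) (cong (residue ws) (transpose-matchʳ a b b (a≢b ∘ sym) refl))))
                (cong (_* toℕ (residue ws a)) b≡1+a)
    before : ∀ x y z → x * y + suc x * z ≡ (x * y + x * z) + z
    before = ℕSolver.solve-∀
    after : ∀ x y z → x * z + suc x * y ≡ (x * y + x * z) + y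
    after = ℕSolver.solve-∀
    ineq : f a + f b < f′ a + f′ b
    ineq = subst₂ _<_
      (sym (trans (cong (λ z → f a + z * toℕ (residue ws b)) b≡1+a) (before (toℕ a) _ _)))
      (sym (trans (cong₂ _+_ f′a f′b) (after (toℕ a) _ _)))
      (ℕP.+-monoʳ-< _ descent)

  noDescent⇒increasingOnBlocks : ∀ ws → ¬ (∃ λ a → ∃ λ b → Descent ws a b) → IncreasingOnBlocks p (residue ws)
  noDescent⇒increasingOnBlocks ws none a b a<b = chain (toℕ b ∸ suc (toℕ a)) a b (sym (ℕP.m+[n∸m]≡n a<b))
    where
    adjacent : ∀ a b → AllowedGen p (a , b) → residue ws a F.< residue ws b
    adjacent a b allowed@(b≡1+a , _) with toℕ (residue ws b) <? toℕ (residue ws a)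
    ... | yes descent = ⊥-elim (none (a , b , allowed , descent))
    ... | no ¬descent = ℕP.≤∧≢⇒< (ℕP.≮⇒≥ ¬descent) λ e →
      ℕP.<⇒≢ (ℕP.n<1+n (toℕ a)) (trans (cong toℕ (residue-injective ws (FP.toℕ-injective e))) b≡1+a)
    chain : ∀ d a b → toℕ b ≡ suc (toℕ a + d) → SameBlock p a b → residue ws a F.< residue ws b
    chain zero a b b≡ blk = adjacent a b (sameBlock-adjacent⇒allowed (trans b≡ (cong suc (ℕP.+-identityʳ _))) blk)
    chain (suc d) a b b≡ blk =
      ℕP.<-trans (chain d a c c≡ (sameBlock-shrinkʳ c<b blk))
                 (adjacent c b (sameBlock-adjacent⇒allowed b≡1+c (sameBlock-shrinkˡ a≤c blk)))
      where
      c<n : suc (toℕ a + d) < n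
      c<n = ℕP.<-trans (subst (suc (toℕ a + d) <_) (sym (trans b≡ (cong suc (ℕP.+-suc _ d)))) (ℕP.n<1+n _)) (FP.toℕ<n b)
      c : Fin n
      c = fromℕ< c<n
      c≡ : toℕ c ≡ suc (toℕ a + d)
      c≡ = FP.toℕ-fromℕ< c<n
      b≡1+c : toℕ b ≡ suc (toℕ c)
      b≡1+c = trans b≡ (trans (cong suc (ℕP.+-suc _ d)) (cong suc (sym c≡)))
      c<b : toℕ c < toℕ b
      c<b = subst (toℕ c <_) (sym b≡1+c) (ℕP.n<1+n _)
      a≤c : toℕ a ≤ toℕ c
      a≤c = subst (toℕ a ≤_) (sym c≡) (ℕP.≤-trans (ℕP.m≤m+n (toℕ a) d) (ℕP.n≤1+n _))

  sortFrom : ∀ fuel ws → All (AllowedGen p) ws → n * (n * n) < potential ws + fuel →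
             Σ Word λ ws′ → All (AllowedGen p) ws′ × IncreasingOnBlocks p (residue ws′)
  sortFrom zero ws gs out = ⊥-elim (ℕP.<⇒≱ out (subst (_≤ n * (n * n)) (sym (ℕP.+-identityʳ _)) (potential-bound ws)))
  sortFrom (suc fuel) ws gs out with descent? ws
  ... | no none = ws , gs , noDescent⇒increasingOnBlocks ws none
  ... | yes (a , b , descent) =
        sortFrom fuel (ws ++ (a , b) ∷ []) (AllP.++⁺ gs (proj₁ descent ∷ []))
          (ℕP.<-≤-trans out (ℕP.≤-trans (ℕP.≤-reflexive (ℕP.+-suc (potential ws) fuel))
                                         (ℕP.+-monoˡ-≤ fuel (potential-step ws a b descent))))

  factorisation : Σ Word λ ws → All (AllowedGen p) ws × MinRep p (w ∘ₚ flip (wordPermutation ws))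
  factorisation with sortFrom (suc (n * (n * n))) [] [] (ℕP.m≤n+m _ _)
  ... | ws , gs , incr = ws , gs , λ a b a<b blk →
    subst₂ F._<_ (cong (w ⟨$⟩ˡ_) (sym (wordPermutation-correct ws a)))
                 (cong (w ⟨$⟩ˡ_) (sym (wordPermutation-correct ws b))) (incr a b a<b blk)

preservesBlocks⇒InSλ : ∀ {n} p (σ : Permutation′ n) → PreservesBlocks p (σ ⟨$⟩ʳ_) → InSλ p (σ ⟨$⟩ʳ_)
preservesBlocks⇒InSλ {n} p σ blocks with BubbleSort.factorisation p σ
... | ws , gs , minRep = ws , gs , λ x → begin
  σ ⟨$⟩ʳ x                                  ≡⟨ cong (σ ⟨$⟩ʳ_) (residue≗id x) ⟨
  σ ⟨$⟩ʳ (σ ⟨$⟩ˡ (wordPermutation ws ⟨$⟩ʳ x)) ≡⟨ inverseʳ σ ⟩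
  wordPermutation ws ⟨$⟩ʳ x                 ≡⟨ wordPermutation-correct ws x ⟩
  wordPerm ws x                             ∎
  where
  open ≡-Reasoning
  residue : Fin n → Fin n
  residue a = σ ⟨$⟩ˡ (wordPermutation ws ⟨$⟩ʳ a)
  residue≗id : ∀ x → residue x ≡ x
  residue≗id = preservesBlocks∧increasingOnBlocks⇒≗id
    (preservesBlocks-∘ (preservesBlocks-inverse σ blocks)
      (preservesBlocks-resp-≗ (sym ∘ wordPermutation-correct ws) (wordPerm-preservesBlocks ws gs)))
    minRep

-- y⁻¹ y′ preserves the blocks and, since v′⁻¹ = v⁻¹ ∘ y⁻¹ y′ with both
-- v⁻¹ and v′⁻¹ increasing on blocks, is increasing on them: so it is the identity.
factorisation-unique : ∀ {n} p (y y′ v v′ : Permutation′ n) →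
  PreservesBlocks p (y ⟨$⟩ʳ_) → PreservesBlocks p (y′ ⟨$⟩ʳ_) → MinRep p v → MinRep p v′ →
  (∀ x → y ⟨$⟩ʳ (v ⟨$⟩ʳ x) ≡ y′ ⟨$⟩ʳ (v′ ⟨$⟩ʳ x)) →
  (∀ a → y ⟨$⟩ʳ a ≡ y′ ⟨$⟩ʳ a) × (∀ x → v ⟨$⟩ʳ x ≡ v′ ⟨$⟩ʳ x)
factorisation-unique {n} p y y′ v v′ blocks blocks′ minRep minRep′ yv≗y′v′ = y≗y′ , v≗v′
  where
  z : Fin n → Fin n
  z b = y ⟨$⟩ˡ (y′ ⟨$⟩ʳ b)
  z-blocks : PreservesBlocks p z
  z-blocks = preservesBlocks-∘ (preservesBlocks-inverse y blocks) blocks′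
  v′⁻¹≗v⁻¹∘z : ∀ b → v′ ⟨$⟩ˡ b ≡ v ⟨$⟩ˡ z b
  v′⁻¹≗v⁻¹∘z b = begin
    v′ ⟨$⟩ˡ b                                  ≡⟨ inverseˡ v ⟨
    v ⟨$⟩ˡ (v ⟨$⟩ʳ (v′ ⟨$⟩ˡ b))                 ≡⟨ cong (v ⟨$⟩ˡ_) (inverseˡ y) ⟨
    v ⟨$⟩ˡ (y ⟨$⟩ˡ (y ⟨$⟩ʳ (v ⟨$⟩ʳ (v′ ⟨$⟩ˡ b)))) ≡⟨ cong (λ t → v ⟨$⟩ˡ (y ⟨$⟩ˡ t)) (yv≗y′v′ _) ⟩
    v ⟨$⟩ˡ (y ⟨$⟩ˡ (y′ ⟨$⟩ʳ (v′ ⟨$⟩ʳ (v′ ⟨$⟩ˡ b)))) ≡⟨ cong (λ t → v ⟨$⟩ˡ z t) (inverseʳ v′) ⟩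
    v ⟨$⟩ˡ z b                                 ∎
    where open ≡-Reasoning
  z-increasing : IncreasingOnBlocks p z
  z-increasing a b a<b blk with ℕP.<-cmp (toℕ (z a)) (toℕ (z b))
  ... | tri< za<zb _ _ = za<zb
  ... | tri≈ _ za≡zb _ = ⊥-elim (ℕP.<⇒≢ a<b (cong toℕ
          (permutation-injective y′ (permutation-injective (flip y) (FP.toℕ-injective za≡zb)))))
  ... | tri> _ _ zb<za = ⊥-elim (ℕP.<-asym
          (subst₂ F._<_ (sym (v′⁻¹≗v⁻¹∘z b)) (sym (v′⁻¹≗v⁻¹∘z a)) (minRep (z b) (z a) zb<za (z-sameBlock blk)))
          (minRep′ a b a<b blk))
    where
    z-sameBlock : SameBlock p a b → SameBlock p (z b) (z a)
    z-sameBlock (inj₁ b<p) = inj₁ (proj₁ (z-blocks a) (ℕP.<-trans a<b b<p))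
    z-sameBlock (inj₂ p≤a) = inj₂ (proj₂ (z-blocks b) (ℕP.≤-trans p≤a (ℕP.<⇒≤ a<b)))
  y≗y′ : ∀ a → y ⟨$⟩ʳ a ≡ y′ ⟨$⟩ʳ a
  y≗y′ a = trans (cong (y ⟨$⟩ʳ_) (sym (preservesBlocks∧increasingOnBlocks⇒≗id z-blocks z-increasing a))) (inverseʳ y)
  v≗v′ : ∀ x → v ⟨$⟩ʳ x ≡ v′ ⟨$⟩ʳ x
  v≗v′ x = permutation-injective y (trans (yv≗y′v′ x) (sym (y≗y′ _)))

-- Otherwise σ would map the p elements of the first block and x, p + 1 in all, into it.
preservesFirstBlock⇒preservesBlocks : ∀ {n} p (σ : Permutation′ n) → p ≤ n →
  (∀ x → toℕ x < p → toℕ (σ ⟨$⟩ʳ x) < p) → PreservesBlocks p (σ ⟨$⟩ʳ_)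
preservesFirstBlock⇒preservesBlocks {n} p σ p≤n first x = first x , second
  where
  second : p ≤ toℕ x → p ≤ toℕ (σ ⟨$⟩ʳ x)
  second p≤x with toℕ (σ ⟨$⟩ʳ x) <? p
  ... | no σx≮p = ℕP.≮⇒≥ σx≮p
  ... | yes σx<p = ⊥-elim (collision (FP.pigeonhole (ℕP.n<1+n p) image))
    where
    source : (i : Fin (suc p)) → Dec (toℕ i < p) → Fin n
    source i (yes i<p) = fromℕ< (ℕP.<-≤-trans i<p p≤n)
    source i (no _) = x
    lands : ∀ i d → toℕ (σ ⟨$⟩ʳ source i d) < p
    lands i (yes i<p) = first _ (subst (_< p) (sym (FP.toℕ-fromℕ< _)) i<p)
    lands i (no _) = σx<p
    image : Fin (suc p) → Fin p
    image i = fromℕ< (lands i (toℕ i <? p))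
    collision : (∃ λ i → ∃ λ j → i F.< j × image i ≡ image j) → ⊥
    collision (i , j , i<j , same) = distinct (toℕ i <? p) (toℕ j <? p) σsame
      where
      σsame : σ ⟨$⟩ʳ source i (toℕ i <? p) ≡ σ ⟨$⟩ʳ source j (toℕ j <? p)
      σsame = FP.toℕ-injective (trans (sym (FP.toℕ-fromℕ< _)) (trans (cong toℕ same) (FP.toℕ-fromℕ< _)))
      i<p : toℕ i < p
      i<p = ℕP.<-≤-trans i<j (ℕP.≤-pred (FP.toℕ<n j))
      distinct : ∀ di dj → σ ⟨$⟩ʳ source i di ≡ σ ⟨$⟩ʳ source j dj → ⊥
      distinct (no i≮p) _ _ = i≮p i<p
      distinct (yes _) (yes _) e = ℕP.<⇒≢ i<j
        (trans (sym (FP.toℕ-fromℕ< _)) (trans (cong toℕ (permutation-injective σ e)) (FP.toℕ-fromℕ< _)))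
      distinct (yes i<p′) (no _) e = ℕP.<⇒≱ (subst (_< p) (sym (FP.toℕ-fromℕ< _)) i<p′)
        (subst (λ t → p ≤ toℕ t) (sym (permutation-injective σ e)) p≤x)

vkℕ-head : ∀ p q k x → x < k → vkℕ p q k x ≡ p + x
vkℕ-head p q k x x<k with x <? k
... | yes _ = refl
... | no x≮k = ⊥-elim (x≮k x<k)

vkℕ-pivot : ∀ p q k → vkℕ p q k k ≡ 0
vkℕ-pivot p q k with k <? k | k ≟ k
... | yes k<k | _ = ⊥-elim (ℕP.n≮n k k<k)
... | no _ | yes _ = refl
... | no _ | no k≢k = ⊥-elim (k≢k refl)

vkℕ-middle : ∀ p q k x → k ≤ x → suc x ≤ q → vkℕ p q k (suc x) ≡ p + x
vkℕ-middle p q k x k≤x 1+x≤q with suc x <? k | suc x ≟ k | suc x ≤? q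
... | yes 1+x<k | _ | _ = ⊥-elim (ℕP.<-asym 1+x<k (s≤s k≤x))
... | no _ | yes 1+x≡k | _ = ⊥-elim (ℕP.<⇒≢ (s≤s k≤x) (sym 1+x≡k))
... | no _ | no _ | yes _ = cong (_∸ 1) (ℕP.+-suc p x)
... | no _ | no _ | no 1+x≰q = ⊥-elim (1+x≰q 1+x≤q)

vkℕ-tail : ∀ p q k x → k ≤ q → q < x → vkℕ p q k x ≡ x ∸ q
vkℕ-tail p q k x k≤q q<x with x <? k | x ≟ k | x ≤? q
... | yes x<k | _ | _ = ⊥-elim (ℕP.<-asym x<k (ℕP.≤-<-trans k≤q q<x))
... | no _ | yes x≡k | _ = ⊥-elim (ℕP.<⇒≢ (ℕP.≤-<-trans k≤q q<x) (sym x≡k))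
... | no _ | no _ | yes x≤q = ⊥-elim (ℕP.<⇒≱ q<x x≤q)
... | no _ | no _ | no _ = refl

data DomainView (k q x : ℕ) : Set where
  head   : x < k → DomainView k q x
  pivot  : x ≡ k → DomainView k q x
  middle : ∀ x′ → x ≡ suc x′ → k ≤ x′ → x ≤ q → DomainView k q x
  tail   : q < x → DomainView k q x

domainView : ∀ k q x → DomainView k q x
domainView k q x with ℕP.<-cmp x k
... | tri< x<k _ _ = head x<k
... | tri≈ _ x≡k _ = pivot x≡k
... | tri> _ _ k<x with x ≤? q
...   | no x≰q = tail (ℕP.≰⇒> x≰q)
...   | yes x≤q with x | k<x
...     | suc x′ | s≤s k≤x′ = middle x′ refl k≤x′ x≤q

vkℕ⁻¹ : ℕ → ℕ → ℕ → ℕ → ℕ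
vkℕ⁻¹ p q k a with a ≟ 0 | a <? p | a <? p + k
... | yes _ | _ | _ = k
... | no _ | yes _ | _ = a + q
... | no _ | no _ | yes _ = a ∸ p
... | no _ | no _ | no _ = suc (a ∸ p)

data CodomainView (p k a : ℕ) : Set where
  origin      : a ≡ 0 → CodomainView p k a
  first       : 0 < a → a < p → CodomainView p k a
  second-head : ∀ d → a ≡ p + d → d < k → CodomainView p k a
  second-tail : ∀ d → a ≡ p + d → k ≤ d → CodomainView p k a

codomainView : ∀ p k a → CodomainView p k a
codomainView p k a with a ≟ 0 | a <? p
... | yes a≡0 | _ = origin a≡0
... | no a≢0 | yes a<p = first (ℕP.n≢0⇒n>0 a≢0) a<p
... | no _ | no a≮p with a <? p + k
...   | yes a<p+k = second-head (a ∸ p) a≡ (ℕP.+-cancelˡ-< p _ _ (subst (_< p + k) a≡ a<p+k))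
  where a≡ = sym (ℕP.m+[n∸m]≡n (ℕP.≮⇒≥ a≮p))
...   | no a≮p+k = second-tail (a ∸ p) a≡ (ℕP.+-cancelˡ-≤ p _ _ (subst (p + k ≤_) a≡ (ℕP.≮⇒≥ a≮p+k)))
  where a≡ = sym (ℕP.m+[n∸m]≡n (ℕP.≮⇒≥ a≮p))

vkℕ⁻¹-first : ∀ p q k a → 0 < a → a < p → vkℕ⁻¹ p q k a ≡ a + q
vkℕ⁻¹-first p q k a 0<a a<p with a ≟ 0 | a <? p
... | yes a≡0 | _ = ⊥-elim (ℕP.<⇒≢ 0<a (sym a≡0))
... | no _ | yes _ = refl
... | no _ | no a≮p = ⊥-elim (a≮p a<p)

vkℕ⁻¹-second-head : ∀ p q k d → 1 ≤ p → d < k → vkℕ⁻¹ p q k (p + d) ≡ d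
vkℕ⁻¹-second-head p q k d 1≤p d<k with p + d ≟ 0 | p + d <? p | p + d <? p + k
... | yes p+d≡0 | _ | _ = ⊥-elim (ℕP.<⇒≢ (ℕP.≤-trans 1≤p (ℕP.m≤m+n p d)) (sym p+d≡0))
... | no _ | yes p+d<p | _ = ⊥-elim (ℕP.<⇒≱ p+d<p (ℕP.m≤m+n p d))
... | no _ | no _ | yes _ = ℕP.m+n∸m≡n p d
... | no _ | no _ | no p+d≮p+k = ⊥-elim (p+d≮p+k (ℕP.+-monoʳ-< p d<k))

vkℕ⁻¹-second-tail : ∀ p q k d → 1 ≤ p → k ≤ d → vkℕ⁻¹ p q k (p + d) ≡ suc d
vkℕ⁻¹-second-tail p q k d 1≤p k≤d with p + d ≟ 0 | p + d <? p | p + d <? p + k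
... | yes p+d≡0 | _ | _ = ⊥-elim (ℕP.<⇒≢ (ℕP.≤-trans 1≤p (ℕP.m≤m+n p d)) (sym p+d≡0))
... | no _ | yes p+d<p | _ = ⊥-elim (ℕP.<⇒≱ p+d<p (ℕP.m≤m+n p d))
... | no _ | no _ | yes p+d<p+k = ⊥-elim (ℕP.<⇒≱ p+d<p+k (ℕP.+-monoʳ-≤ p k≤d))
... | no _ | no _ | no _ = cong suc (ℕP.m+n∸m≡n p d)

crossesBlocks : ∀ {p a b} → a < p → p ≤ b → ¬ (b < p ⊎ p ≤ a)
crossesBlocks a<p p≤b (inj₁ b<p) = ℕP.<⇒≱ b<p p≤b
crossesBlocks a<p p≤b (inj₂ p≤a) = ℕP.<⇒≱ a<p p≤a

toℕ-clampFin : ∀ {n} (d : Fin n) m → m < n → toℕ (clampFin d m) ≡ m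
toℕ-clampFin {n} d m m<n with m <? n
... | yes m<n′ = FP.toℕ-fromℕ< m<n′
... | no m≮n = ⊥-elim (m≮n m<n)

module Vk (p q k : ℕ) (1≤p : 1 ≤ p) (k≤q : k ≤ q) where
  n : ℕ
  n = p + q

  q<n : q < n
  q<n = ℕP.+-monoˡ-≤ q 1≤p

  ∸q<p : ∀ x → q < x → x < n → x ∸ q < p
  ∸q<p x q<x x<n = subst (x ∸ q <_) (ℕP.m+n∸m≡n q p) (ℕP.∸-monoˡ-< (subst (x <_) (ℕP.+-comm p q) x<n) (ℕP.<⇒≤ q<x))

  vkℕ<n : ∀ x → x < n → vkℕ p q k x < n
  vkℕ<n x x<n with domainView k q x
  ... | head x<k = subst (_< n) (sym (vkℕ-head p q k x x<k)) (ℕP.+-monoʳ-< p (ℕP.<-≤-trans x<k k≤q))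
  ... | pivot refl = subst (_< n) (sym (vkℕ-pivot p q k)) (ℕP.≤-trans 1≤p (ℕP.m≤m+n p q))
  ... | middle x′ refl k≤x′ x≤q = subst (_< n) (sym (vkℕ-middle p q k x′ k≤x′ x≤q)) (ℕP.+-monoʳ-< p x≤q)
  ... | tail q<x = subst (_< n) (sym (vkℕ-tail p q k x k≤q q<x)) (ℕP.<-≤-trans (∸q<p x q<x x<n) (ℕP.m≤m+n p q))

  vkℕ⁻¹<n : ∀ a → a < n → vkℕ⁻¹ p q k a < n
  vkℕ⁻¹<n a a<n with codomainView p k a
  ... | origin refl = ℕP.≤-<-trans k≤q q<n
  ... | first 0<a a<p = subst (_< n) (sym (vkℕ⁻¹-first p q k a 0<a a<p)) (ℕP.+-monoˡ-< q a<p)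
  ... | second-head d refl d<k = subst (_< n) (sym (vkℕ⁻¹-second-head p q k d 1≤p d<k)) (ℕP.<-trans d<k (ℕP.≤-<-trans k≤q q<n))
  ... | second-tail d refl k≤d = subst (_< n) (sym (vkℕ⁻¹-second-tail p q k d 1≤p k≤d)) (ℕP.≤-<-trans (ℕP.+-cancelˡ-< p d q a<n) q<n)

  vkℕ∘vkℕ⁻¹ : ∀ a → a < n → vkℕ p q k (vkℕ⁻¹ p q k a) ≡ a
  vkℕ∘vkℕ⁻¹ a a<n with codomainView p k a
  ... | origin refl = vkℕ-pivot p q k
  ... | first 0<a a<p = trans (cong (vkℕ p q k) (vkℕ⁻¹-first p q k a 0<a a<p))
      (trans (vkℕ-tail p q k (a + q) k≤q (ℕP.+-monoˡ-< q 0<a)) (ℕP.m+n∸n≡m a q))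
  ... | second-head d refl d<k = trans (cong (vkℕ p q k) (vkℕ⁻¹-second-head p q k d 1≤p d<k)) (vkℕ-head p q k d d<k)
  ... | second-tail d refl k≤d = trans (cong (vkℕ p q k) (vkℕ⁻¹-second-tail p q k d 1≤p k≤d))
      (vkℕ-middle p q k d k≤d (ℕP.+-cancelˡ-< p d q a<n))

  vkℕ⁻¹∘vkℕ : ∀ x → x < n → vkℕ⁻¹ p q k (vkℕ p q k x) ≡ x
  vkℕ⁻¹∘vkℕ x x<n with domainView k q x
  ... | head x<k = trans (cong (vkℕ⁻¹ p q k) (vkℕ-head p q k x x<k)) (vkℕ⁻¹-second-head p q k x 1≤p x<k)
  ... | pivot refl = cong (vkℕ⁻¹ p q k) (vkℕ-pivot p q k)
  ... | middle x′ refl k≤x′ x≤q = trans (cong (vkℕ⁻¹ p q k) (vkℕ-middle p q k x′ k≤x′ x≤q)) (vkℕ⁻¹-second-tail p q k x′ 1≤p k≤x′)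
  ... | tail q<x = trans (cong (vkℕ⁻¹ p q k) (vkℕ-tail p q k x k≤q q<x))
      (trans (vkℕ⁻¹-first p q k (x ∸ q) (ℕP.m<n⇒0<n∸m q<x) (∸q<p x q<x x<n)) (ℕP.m∸n+n≡m (ℕP.<⇒≤ q<x)))

  vkℕ⁻¹-increasing : ∀ a b → a < b → b < n → (b < p ⊎ p ≤ a) → vkℕ⁻¹ p q k a < vkℕ⁻¹ p q k b
  vkℕ⁻¹-increasing a b a<b b<n blk with codomainView p k a | codomainView p k b
  ... | _ | origin refl = ⊥-elim (ℕP.n≮0 a<b)
  ... | origin refl | first 0<b b<p =
    subst (k <_) (sym (vkℕ⁻¹-first p q k b 0<b b<p)) (ℕP.≤-<-trans k≤q (ℕP.+-monoˡ-< q 0<b))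
  ... | first 0<a a<p | first 0<b b<p =
    subst₂ _<_ (sym (vkℕ⁻¹-first p q k a 0<a a<p)) (sym (vkℕ⁻¹-first p q k b 0<b b<p)) (ℕP.+-monoˡ-< q a<b)
  ... | second-head d refl _ | first _ b<p = ⊥-elim (ℕP.<-asym b<p (ℕP.≤-<-trans (ℕP.m≤m+n p d) a<b))
  ... | second-tail d refl _ | first _ b<p = ⊥-elim (ℕP.<-asym b<p (ℕP.≤-<-trans (ℕP.m≤m+n p d) a<b))
  ... | origin refl | second-head e refl _ = ⊥-elim (crossesBlocks 1≤p (ℕP.m≤m+n p e) blk)
  ... | origin refl | second-tail e refl _ = ⊥-elim (crossesBlocks 1≤p (ℕP.m≤m+n p e) blk)
  ... | first _ a<p | second-head e refl _ = ⊥-elim (crossesBlocks a<p (ℕP.m≤m+n p e) blk)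
  ... | first _ a<p | second-tail e refl _ = ⊥-elim (crossesBlocks a<p (ℕP.m≤m+n p e) blk)
  ... | second-head d refl d<k | second-head e refl e<k =
    subst₂ _<_ (sym (vkℕ⁻¹-second-head p q k d 1≤p d<k)) (sym (vkℕ⁻¹-second-head p q k e 1≤p e<k)) (ℕP.+-cancelˡ-< p d e a<b)
  ... | second-head d refl d<k | second-tail e refl k≤e =
    subst₂ _<_ (sym (vkℕ⁻¹-second-head p q k d 1≤p d<k)) (sym (vkℕ⁻¹-second-tail p q k e 1≤p k≤e)) (s≤s (ℕP.≤-trans (ℕP.<⇒≤ d<k) k≤e))
  ... | second-tail d refl k≤d | second-tail e refl k≤e =
    subst₂ _<_ (sym (vkℕ⁻¹-second-tail p q k d 1≤p k≤d)) (sym (vkℕ⁻¹-second-tail p q k e 1≤p k≤e)) (s≤s (ℕP.+-cancelˡ-< p d e a<b))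
  ... | second-tail d refl k≤d | second-head e refl e<k =
    ⊥-elim (ℕP.<⇒≱ (ℕP.<-≤-trans (ℕP.+-cancelˡ-< p d e a<b) (ℕP.<⇒≤ e<k)) k≤d)

  toℕ-vk : ∀ x → toℕ (vk p q k x) ≡ vkℕ p q k (toℕ x)
  toℕ-vk x = toℕ-clampFin x _ (vkℕ<n (toℕ x) (FP.toℕ<n x))

  vk⁻¹ : Fin n → Fin n
  vk⁻¹ a = clampFin a (vkℕ⁻¹ p q k (toℕ a))

  toℕ-vk⁻¹ : ∀ a → toℕ (vk⁻¹ a) ≡ vkℕ⁻¹ p q k (toℕ a)
  toℕ-vk⁻¹ a = toℕ-clampFin a _ (vkℕ⁻¹<n (toℕ a) (FP.toℕ<n a))

  vkₚ : Permutation′ n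
  vkₚ = Perm.permutation (vk p q k) vk⁻¹
    (λ a → FP.toℕ-injective (trans (toℕ-vk (vk⁻¹ a)) (trans (cong (vkℕ p q k) (toℕ-vk⁻¹ a)) (vkℕ∘vkℕ⁻¹ (toℕ a) (FP.toℕ<n a)))))
    (λ x → FP.toℕ-injective (trans (toℕ-vk⁻¹ (vk p q k x)) (trans (cong (vkℕ⁻¹ p q k) (toℕ-vk x)) (vkℕ⁻¹∘vkℕ (toℕ x) (FP.toℕ<n x)))))

  vkₚ-minRep : MinRep p vkₚ
  vkₚ-minRep a b a<b blk = subst₂ _<_ (sym (toℕ-vk⁻¹ a)) (sym (toℕ-vk⁻¹ b)) (vkℕ⁻¹-increasing (toℕ a) (toℕ b) a<b (FP.toℕ<n b) blk)

  -- A shadow of the condition v ≥ v_k that survives multiplication by S_λ on the left.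
  VkPattern : (Fin n → Fin n) → Set
  VkPattern u = (∀ x → toℕ x < k → p ≤ toℕ (u x)) × (∀ x → q < toℕ x → toℕ (u x) < p)

  vkPattern-vk : VkPattern (vk p q k)
  vkPattern-vk =
    (λ x x<k → subst (p ≤_) (sym (trans (toℕ-vk x) (vkℕ-head p q k (toℕ x) x<k))) (ℕP.m≤m+n p _)) ,
    (λ x q<x → subst (_< p) (sym (trans (toℕ-vk x) (vkℕ-tail p q k (toℕ x) k≤q q<x))) (∸q<p (toℕ x) q<x (FP.toℕ<n x)))

  vkPattern-resp-≗ : ∀ {u w} → (∀ x → u x ≡ w x) → VkPattern u → VkPattern w
  vkPattern-resp-≗ eq (early , late) =
    (λ x x<k → subst (λ t → p ≤ toℕ t) (eq x) (early x x<k)) , (λ x q<x → subst (λ t → toℕ t < p) (eq x) (late x q<x))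

  -- Bruhat steps preserve the pattern because the positions below k form an
  -- initial segment and those above q a final one.
  vkPattern-step : ∀ {u′ u : Fin n → Fin n} (i j : Fin n) → i F.< j → u′ i F.< u′ j →
                   (∀ x → u x ≡ u′ (transpose i j ⟨$⟩ʳ x)) → VkPattern u′ → VkPattern u
  vkPattern-step {u′} {u} i j i<j u′i<u′j eq (early , late) = early′ , late′
    where
    early′ : ∀ x → toℕ x < k → p ≤ toℕ (u x)
    early′ x x<k with transposeView i j x
    ... | at-i refl e = subst (λ t → p ≤ toℕ t) (sym (trans (eq x) (cong u′ e))) (ℕP.≤-trans (early x x<k) (ℕP.<⇒≤ u′i<u′j))
    ... | at-j refl e = subst (λ t → p ≤ toℕ t) (sym (trans (eq x) (cong u′ e))) (early i (ℕP.<-trans i<j x<k))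
    ... | other e = subst (λ t → p ≤ toℕ t) (sym (trans (eq x) (cong u′ e))) (early x x<k)
    late′ : ∀ x → q < toℕ x → toℕ (u x) < p
    late′ x q<x with transposeView i j x
    ... | at-i refl e = subst (λ t → toℕ t < p) (sym (trans (eq x) (cong u′ e))) (late j (ℕP.<-trans q<x i<j))
    ... | at-j refl e = subst (λ t → toℕ t < p) (sym (trans (eq x) (cong u′ e))) (ℕP.<-trans u′i<u′j (late x q<x))
    ... | other e = subst (λ t → toℕ t < p) (sym (trans (eq x) (cong u′ e))) (late x q<x)

  vkPattern-mono-≤B : ∀ {u w} → u ≤B w → VkPattern u → VkPattern w
  vkPattern-mono-≤B (≤B-refl eq) = vkPattern-resp-≗ eq
  vkPattern-mono-≤B (≤B-step u≤w′ i j i<j w′i<w′j eq) = vkPattern-step i j i<j w′i<w′j eq ∘ vkPattern-mono-≤B u≤w′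

  vkPattern-preservesBlocks-∘ : ∀ {y v : Fin n → Fin n} → PreservesBlocks p y → VkPattern v → VkPattern (y ∘ v)
  vkPattern-preservesBlocks-∘ blocks (early , late) =
    (λ x x<k → proj₂ (blocks _) (early x x<k)) , (λ x q<x → proj₁ (blocks _) (late x q<x))

lookup-ext : ∀ {A : Set} {n} {u v : Vec A n} → (∀ i → lookup u i ≡ lookup v i) → u ≡ v
lookup-ext {u = u} {v} eq = trans (sym (VP.tabulate∘lookup u)) (trans (VP.tabulate-cong eq) (VP.tabulate∘lookup v))

module Action {n : ℕ} (σ : Permutation′ n) where
  permuteMon : Mon n → Mon n
  permuteMon e = tabulate λ j → lookup e (σ ⟨$⟩ˡ j)

  unpermuteMon : Mon n → Mon n
  unpermuteMon m = tabulate λ i → lookup m (σ ⟨$⟩ʳ i)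

  unpermute∘permute : ∀ m → unpermuteMon (permuteMon m) ≡ m
  unpermute∘permute m = lookup-ext λ i →
    trans (VP.lookup∘tabulate _ i) (trans (VP.lookup∘tabulate _ (σ ⟨$⟩ʳ i)) (cong (lookup m) (inverseˡ σ)))

  permuteMon-zipWith : ∀ e f → permuteMon (zipWith _+_ e f) ≡ zipWith _+_ (permuteMon e) (permuteMon f)
  permuteMon-zipWith e f = lookup-ext λ i → begin
    lookup (permuteMon (zipWith _+_ e f)) i                    ≡⟨ VP.lookup∘tabulate _ i ⟩
    lookup (zipWith _+_ e f) (σ ⟨$⟩ˡ i)                         ≡⟨ VP.lookup-zipWith _+_ (σ ⟨$⟩ˡ i) e f ⟩
    lookup e (σ ⟨$⟩ˡ i) + lookup f (σ ⟨$⟩ˡ i)                   ≡⟨ cong₂ _+_ (VP.lookup∘tabulate _ i) (VP.lookup∘tabulate _ i) ⟨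
    lookup (permuteMon e) i + lookup (permuteMon f) i           ≡⟨ VP.lookup-zipWith _+_ i (permuteMon e) (permuteMon f) ⟨
    lookup (zipWith _+_ (permuteMon e) (permuteMon f)) i        ∎
    where open ≡-Reasoning

  permuteMon-unitMon : ∀ a → permuteMon (unitMon a) ≡ unitMon (σ ⟨$⟩ʳ a)
  permuteMon-unitMon a = lookup-ext entry
    where
    open ≡-Reasoning
    moved⇔ : ∀ i → i ≡ σ ⟨$⟩ʳ a ⇔ σ ⟨$⟩ˡ i ≡ a
    moved⇔ i = mk⇔ (λ e → trans (cong (σ ⟨$⟩ˡ_) e) (inverseˡ σ)) (λ e → trans (sym (inverseʳ σ)) (cong (σ ⟨$⟩ʳ_) e))
    entry : ∀ i → lookup (permuteMon (unitMon a)) i ≡ lookup (unitMon (σ ⟨$⟩ʳ a)) i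
    entry i = begin
      lookup (permuteMon (unitMon a)) i               ≡⟨ VP.lookup∘tabulate _ i ⟩
      lookup (unitMon a) (σ ⟨$⟩ˡ i)                   ≡⟨ VP.lookup∘tabulate _ (σ ⟨$⟩ˡ i) ⟩
      (if does ((σ ⟨$⟩ˡ i) FP.≟ a) then 1 else 0)    ≡⟨ cong (if_then 1 else 0) (does-⇔ (moved⇔ i) (i FP.≟ (σ ⟨$⟩ʳ a)) ((σ ⟨$⟩ˡ i) FP.≟ a)) ⟨
      (if does (i FP.≟ (σ ⟨$⟩ʳ a)) then 1 else 0)    ≡⟨ VP.lookup∘tabulate _ i ⟨
      lookup (unitMon (σ ⟨$⟩ʳ a)) i                   ∎

  permuteMon-replicate : permuteMon (replicate n 0) ≡ replicate n 0
  permuteMon-replicate = lookup-ext λ i →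
    trans (VP.lookup∘tabulate _ i) (trans (VP.lookup-replicate (σ ⟨$⟩ˡ i) 0) (sym (VP.lookup-replicate i 0)))

  actP-oneP : actP σ oneP ≡ oneP
  actP-oneP = cong (λ e → (+ 1 , e) ∷ []) permuteMon-replicate

  actP-linP : ∀ a b → actP σ (linP a b) ≡ linP (σ ⟨$⟩ʳ a) (σ ⟨$⟩ʳ b)
  actP-linP a b = cong₂ (λ u v → (+ 1 , u) ∷ (-[1+ 0 ] , v) ∷ []) (permuteMon-unitMon a) (permuteMon-unitMon b)

  actP-*P : ∀ A B → actP σ (A *P B) ≡ actP σ A *P actP σ B
  actP-*P [] B = refl
  actP-*P ((c , e) ∷ A) B = trans (LP.map-++ _ (map _ B) (concatMap _ A)) (cong₂ _++_ scaled (actP-*P A B))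
    where
    scaled : actP σ (map (λ { (d , f) → (c ℤ.* d , zipWith _+_ e f) }) B)
           ≡ map (λ { (d , f) → (c ℤ.* d , zipWith _+_ (permuteMon e) f) }) (actP σ B)
    scaled = trans (sym (LP.map-∘ B)) (trans (LP.map-cong (λ { (d , f) → cong (c ℤ.* d ,_) (permuteMon-zipWith e f) }) B) (LP.map-∘ B))

  coeff-actP : ∀ P m → coeff (actP σ P) m ≡ coeff P (unpermuteMon m)
  coeff-actP [] m = refl
  coeff-actP ((c , e) ∷ P) m =
    cong₂ ℤ._+_ (cong (if_then c else + 0) (does-⇔ permuted⇔ (VP.≡-dec ℕP._≟_ (permuteMon e) m) (VP.≡-dec ℕP._≟_ e (unpermuteMon m))))
                (coeff-actP P m)
    where
    permuted⇔ : permuteMon e ≡ m ⇔ e ≡ unpermuteMon m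
    permuted⇔ = mk⇔ (λ eq → trans (sym (unpermute∘permute e)) (cong unpermuteMon eq))
      (λ eq → lookup-ext λ j → trans (VP.lookup∘tabulate _ j) (trans (cong (λ v → lookup v (σ ⟨$⟩ˡ j)) eq)
                (trans (VP.lookup∘tabulate _ (σ ⟨$⟩ˡ j)) (cong (lookup m) (inverseʳ σ)))))

  actP≈zero⇒≈zero : ∀ P → actP σ P ≈P zeroP → P ≈P zeroP
  actP≈zero⇒≈zero P σP≈0 m = begin
    coeff P m                                  ≡⟨ cong (coeff P) (unpermute∘permute m) ⟨
    coeff P (unpermuteMon (permuteMon m))      ≡⟨ coeff-actP P (permuteMon m) ⟨
    coeff (actP σ P) (permuteMon m)            ≡⟨ σP≈0 (permuteMon m) ⟩
    + 0                                        ∎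
    where open ≡-Reasoning

module Evaluation {n : ℕ} (t : Fin n → ℤ) where
  ∏ : ∀ {m} → (Fin m → ℤ) → ℤ
  ∏ {zero} f = + 1
  ∏ {suc m} f = f F.zero ℤ.* ∏ (f ∘ F.suc)

  ∏-cong : ∀ {m} {f g : Fin m → ℤ} → (∀ i → f i ≡ g i) → ∏ f ≡ ∏ g
  ∏-cong {zero} eq = refl
  ∏-cong {suc m} eq = cong₂ ℤ._*_ (eq F.zero) (∏-cong (eq ∘ F.suc))

  ∏-* : ∀ {m} (f g : Fin m → ℤ) → ∏ (λ i → f i ℤ.* g i) ≡ ∏ f ℤ.* ∏ g
  ∏-* {zero} f g = refl
  ∏-* {suc m} f g = trans (cong (ℤ._*_ (f F.zero ℤ.* g F.zero)) (∏-* (f ∘ F.suc) (g ∘ F.suc)))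
                          (interchange (f F.zero) (g F.zero) (∏ (f ∘ F.suc)) (∏ (g ∘ F.suc)))
    where
    interchange : ∀ a b c d → a ℤ.* b ℤ.* (c ℤ.* d) ≡ a ℤ.* c ℤ.* (b ℤ.* d)
    interchange = ℤSolver.solve-∀

  ∏-one : ∀ {m} (f : Fin m → ℤ) → (∀ i → f i ≡ + 1) → ∏ f ≡ + 1
  ∏-one {zero} f f≡1 = refl
  ∏-one {suc m} f f≡1 = cong₂ ℤ._*_ (f≡1 F.zero) (∏-one (f ∘ F.suc) (f≡1 ∘ F.suc))

  ∏-indicator : ∀ {m} (s : Fin m → ℤ) a → ∏ (λ i → s i ℤ.^ (if does (i FP.≟ a) then 1 else 0)) ≡ s a
  ∏-indicator {suc m} s F.zero =
    trans (cong₂ ℤ._*_ (ℤP.^-identityʳ (s F.zero)) (∏-one (λ i → s (F.suc i) ℤ.^ 0) λ i → refl)) (ℤP.*-identityʳ (s F.zero))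
  ∏-indicator {suc m} s (F.suc a) = trans (ℤP.*-identityˡ _) (∏-indicator (s ∘ F.suc) a)

  evalMon : Mon n → ℤ
  evalMon e = ∏ λ i → t i ℤ.^ lookup e i

  evalMon-zipWith : ∀ e f → evalMon (zipWith _+_ e f) ≡ evalMon e ℤ.* evalMon f
  evalMon-zipWith e f = trans
    (∏-cong λ i → trans (cong (t i ℤ.^_) (VP.lookup-zipWith _+_ i e f)) (ℤP.^-distribˡ-+-* (t i) (lookup e i) (lookup f i)))
    (∏-* (λ i → t i ℤ.^ lookup e i) (λ i → t i ℤ.^ lookup f i))

  evalMon-unitMon : ∀ a → evalMon (unitMon a) ≡ t a
  evalMon-unitMon a = trans (∏-cong λ i → cong (t i ℤ.^_) (VP.lookup∘tabulate _ i)) (∏-indicator t a)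

  evalMon-replicate : evalMon (replicate n 0) ≡ + 1
  evalMon-replicate = ∏-one _ λ i → cong (t i ℤ.^_) (VP.lookup-replicate i 0)

  evalP : Poly n → ℤ
  evalP [] = + 0
  evalP ((c , e) ∷ P) = c ℤ.* evalMon e ℤ.+ evalP P

  evalP-++ : ∀ A B → evalP (A ++ B) ≡ evalP A ℤ.+ evalP B
  evalP-++ [] B = sym (ℤP.+-identityˡ _)
  evalP-++ ((c , e) ∷ A) B =
    trans (cong (ℤ._+_ (c ℤ.* evalMon e)) (evalP-++ A B)) (sym (ℤP.+-assoc (c ℤ.* evalMon e) (evalP A) (evalP B)))

  evalP-scale : ∀ c e B → evalP (map (λ { (d , f) → (c ℤ.* d , zipWith _+_ e f) }) B) ≡ c ℤ.* evalMon e ℤ.* evalP B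
  evalP-scale c e [] = sym (ℤP.*-zeroʳ (c ℤ.* evalMon e))
  evalP-scale c e ((d , f) ∷ B) =
    trans (cong₂ ℤ._+_ (cong (ℤ._*_ (c ℤ.* d)) (evalMon-zipWith e f)) (evalP-scale c e B))
          (factor-out c d (evalMon e) (evalMon f) (evalP B))
    where
    factor-out : ∀ c d x y r → c ℤ.* d ℤ.* (x ℤ.* y) ℤ.+ c ℤ.* x ℤ.* r ≡ c ℤ.* x ℤ.* (d ℤ.* y ℤ.+ r)
    factor-out = ℤSolver.solve-∀

  evalP-*P : ∀ A B → evalP (A *P B) ≡ evalP A ℤ.* evalP B
  evalP-*P [] B = refl
  evalP-*P ((c , e) ∷ A) B = trans (evalP-++ (map _ B) (concatMap _ A))
    (trans (cong₂ ℤ._+_ (evalP-scale c e B) (evalP-*P A B)) (sym (ℤP.*-distribʳ-+ (evalP B) (c ℤ.* evalMon e) (evalP A))))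

  evalP-oneP : evalP oneP ≡ + 1
  evalP-oneP = cong (λ z → + 1 ℤ.* z ℤ.+ + 0) evalMon-replicate

  evalP-linP : ∀ a b → evalP (linP a b) ≡ t a ℤ.- t b
  evalP-linP a b = trans (cong₂ (λ x y → + 1 ℤ.* x ℤ.+ (-[1+ 0 ] ℤ.* y ℤ.+ + 0)) (evalMon-unitMon a) (evalMon-unitMon b))
                         (normalise (t a) (t b))
    where
    normalise : ∀ x y → + 1 ℤ.* x ℤ.+ (-[1+ 0 ] ℤ.* y ℤ.+ + 0) ≡ x ℤ.- y
    normalise = ℤSolver.solve-∀

  dropMon : Mon n → Poly n → Poly n
  dropMon e = filter λ term → ¬? (VP.≡-dec ℕP._≟_ (proj₂ term) e)

  evalP-dropMon : ∀ e P → evalP P ≡ coeff P e ℤ.* evalMon e ℤ.+ evalP (dropMon e P)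
  evalP-dropMon e [] = refl
  evalP-dropMon e ((c , f) ∷ P) with VP.≡-dec ℕP._≟_ f e
  ... | yes refl = trans (cong (ℤ._+_ (c ℤ.* evalMon f)) (evalP-dropMon f P)) (collect c (coeff P f) (evalMon f) (evalP (dropMon f P)))
    where
    collect : ∀ c d x r → c ℤ.* x ℤ.+ (d ℤ.* x ℤ.+ r) ≡ (c ℤ.+ d) ℤ.* x ℤ.+ r
    collect = ℤSolver.solve-∀
  ... | no _ = trans (cong (ℤ._+_ (c ℤ.* evalMon f)) (evalP-dropMon e P)) (shuffle (c ℤ.* evalMon f) (coeff P e) (evalMon e) (evalP (dropMon e P)))
    where
    shuffle : ∀ a d x r → a ℤ.+ (d ℤ.* x ℤ.+ r) ≡ (+ 0 ℤ.+ d) ℤ.* x ℤ.+ (a ℤ.+ r)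
    shuffle = ℤSolver.solve-∀

  coeff-dropMon-self : ∀ e P → coeff (dropMon e P) e ≡ + 0
  coeff-dropMon-self e [] = refl
  coeff-dropMon-self e ((c , f) ∷ P) with VP.≡-dec ℕP._≟_ f e
  ... | yes refl = coeff-dropMon-self f P
  ... | no f≢e = trans (cong (λ z → z ℤ.+ coeff (dropMon e P) e) (unmatched (VP.≡-dec ℕP._≟_ f e)))
                       (trans (ℤP.+-identityˡ _) (coeff-dropMon-self e P))
    where
    unmatched : (d : Dec (f ≡ e)) → (if does d then c else + 0) ≡ + 0
    unmatched (yes f≡e) = ⊥-elim (f≢e f≡e)
    unmatched (no _) = refl

  coeff-dropMon-other : ∀ e m P → m ≢ e → coeff (dropMon e P) m ≡ coeff P m
  coeff-dropMon-other e m [] m≢e = refl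
  coeff-dropMon-other e m ((c , f) ∷ P) m≢e with VP.≡-dec ℕP._≟_ f e
  ... | yes refl with VP.≡-dec ℕP._≟_ f m
  ...   | yes refl = ⊥-elim (m≢e refl)
  ...   | no _ = trans (coeff-dropMon-other e m P m≢e) (sym (ℤP.+-identityˡ _))
  coeff-dropMon-other e m ((c , f) ∷ P) m≢e | no _ =
    cong (ℤ._+_ (if does (VP.≡-dec ℕP._≟_ f m) then c else + 0)) (coeff-dropMon-other e m P m≢e)

  ≈zero⇒evalP≡0 : ∀ fuel P → L.length P ≤ fuel → P ≈P zeroP → evalP P ≡ + 0
  ≈zero⇒evalP≡0 fuel [] _ _ = refl
  ≈zero⇒evalP≡0 (suc fuel) ((c , e) ∷ P) (s≤s |P|≤fuel) P≈0 =
    trans (evalP-dropMon e ((c , e) ∷ P))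
          (cong₂ (λ a b → a ℤ.* evalMon e ℤ.+ b) (P≈0 e) (≈zero⇒evalP≡0 fuel (dropMon e ((c , e) ∷ P)) shorter dropped≈0))
    where
    drop-head : dropMon e ((c , e) ∷ P) ≡ dropMon e P
    drop-head with VP.≡-dec ℕP._≟_ e e
    ... | yes _ = refl
    ... | no e≢e = ⊥-elim (e≢e refl)
    shorter : L.length (dropMon e ((c , e) ∷ P)) ≤ fuel
    shorter = subst (λ z → L.length z ≤ fuel) (sym drop-head) (ℕP.≤-trans (LP.length-filter _ P) |P|≤fuel)
    dropped≈0 : dropMon e ((c , e) ∷ P) ≈P zeroP
    dropped≈0 m with VP.≡-dec ℕP._≟_ m e
    ... | yes refl = coeff-dropMon-self m ((c , m) ∷ P)
    ... | no m≢e = trans (coeff-dropMon-other e m ((c , e) ∷ P) m≢e) (P≈0 m)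

linearProduct : ∀ {n} → (Fin n → Fin n) → List (Fin n × Fin n) → Poly n
linearProduct u = foldr (λ { (i , j) acc → linP (u i) (u j) *P acc }) oneP

linearProduct-cong : ∀ {n} {u u′ : Fin n → Fin n} → (∀ a → u a ≡ u′ a) → ∀ L → linearProduct u L ≡ linearProduct u′ L
linearProduct-cong eq [] = refl
linearProduct-cong eq ((i , j) ∷ L) = cong₂ _*P_ (cong₂ linP (eq i) (eq j)) (linearProduct-cong eq L)

actP-linearProduct : ∀ {n} (σ : Permutation′ n) (u : Fin n → Fin n) L →
                     actP σ (linearProduct u L) ≡ linearProduct (λ a → σ ⟨$⟩ʳ u a) L
actP-linearProduct σ u [] = Action.actP-oneP σ
actP-linearProduct σ u ((i , j) ∷ L) =
  trans (Action.actP-*P σ (linP (u i) (u j)) (linearProduct u L))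
        (cong₂ _*P_ (Action.actP-linP σ (u i) (u j)) (actP-linearProduct σ u L))

-- Evaluate at t_a = a: every factor t_{u i} - t_{u j} is then a nonzero integer.
linearProduct-nonzero : ∀ {n} (u : Fin n → Fin n) L → All (λ ij → u (proj₁ ij) ≢ u (proj₂ ij)) L →
                        ¬ linearProduct u L ≈P zeroP
linearProduct-nonzero {n} u L distinct ≈0 = evaluation≢0 L distinct (≈zero⇒evalP≡0 _ (linearProduct u L) ℕP.≤-refl ≈0)
  where
  open Evaluation {n} (λ a → + toℕ a)
  evaluation≢0 : ∀ L → All (λ ij → u (proj₁ ij) ≢ u (proj₂ ij)) L → evalP (linearProduct u L) ≢ + 0
  evaluation≢0 [] [] e with ℤP.+-injective (trans (sym evalP-oneP) e)
  ... | ()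
  evaluation≢0 ((i , j) ∷ L) (ui≢uj ∷ distinct) e
    with ℤP.i*j≡0⇒i≡0∨j≡0 (evalP (linP (u i) (u j))) (trans (sym (evalP-*P (linP (u i) (u j)) (linearProduct u L))) e)
  ... | inj₁ factor≡0 = ui≢uj (FP.toℕ-injective (ℤP.+-injective (ℤP.i-j≡0⇒i≡j _ _ (trans (sym (evalP-linP _ _)) factor≡0))))
  ... | inj₂ rest≡0 = evaluation≢0 L distinct rest≡0

skIdx-distinct : ∀ p q k h → All (λ ij → proj₁ ij ≢ proj₂ ij) (SkIdx p q k h)
skIdx-distinct p q k h = All.map (λ { {i , j} (_ , j<i , _) i≡j → ℕP.<⇒≢ j<i (cong toℕ (sym i≡j)) })
  (AllP.all-filter (λ { (i , j) → (vk p q k i F.<? vk p q k j) ×-dec ((j F.<? i) ×-dec (i F.≤? h j)) })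
                   (cartesianProduct (allFin _) (allFin _)))

module Stabiliser (p q k : ℕ) (1≤p : 1 ≤ p) (k≤q : k ≤ q) (h : Fin (p + q) → Fin (p + q)) where
  open Vk p q k 1≤p k≤q
  open Action using (actP≈zero⇒≈zero; coeff-actP; unpermuteMon)

  prodSk-cong : ∀ (y y′ : Fin n → Fin n) → (∀ a → y a ≡ y′ a) → prodSk p q k h y ≡ prodSk p q k h y′
  prodSk-cong y y′ eq = linearProduct-cong (eq ∘ vk p q k) (SkIdx p q k h)

  actP-prodSk : ∀ (σ : Permutation′ n) (y : Fin n → Fin n) → actP σ (prodSk p q k h y) ≡ prodSk p q k h (λ a → σ ⟨$⟩ʳ y a)
  actP-prodSk σ y = actP-linearProduct σ (y ∘ vk p q k) (SkIdx p q k h)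

  prodSk-nonzero : ∀ (y : Permutation′ n) → ¬ prodSk p q k h (y ⟨$⟩ʳ_) ≈P zeroP
  prodSk-nonzero y = linearProduct-nonzero ((y ⟨$⟩ʳ_) ∘ vk p q k) (SkIdx p q k h)
    (All.map (λ i≢j → i≢j ∘ permutation-injective vkₚ ∘ permutation-injective y) (skIdx-distinct p q k h))

  -- v ≥ v_k is not decidable, but equality of coefficients is: argue by double negation.
  Sλ⊆stabiliser : (σ : Permutation′ n) → InSλ p (σ ⟨$⟩ʳ_) → StabFk p q k h σ
  Sλ⊆stabiliser σ σ∈Sλ w P Q P-at Q-at m with BubbleSort.factorisation p w
  ... | ws , gs , v-minRep = decidable-stable (coeff (actP σ P) m ℤP.≟ coeff Q m) λ ≢ → ≢ (below (≢ ∘ above))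
    where
    open ≡-Reasoning
    y = wordPermutation ws
    v = w ∘ₚ flip y
    w≗yv : ∀ x → w ⟨$⟩ʳ x ≡ y ⟨$⟩ʳ (v ⟨$⟩ʳ x)
    w≗yv x = sym (inverseʳ y)
    y∈Sλ : InSλ p (y ⟨$⟩ʳ_)
    y∈Sλ = ws , gs , wordPermutation-correct ws
    σ⁻¹y = y ∘ₚ flip σ
    σ⁻¹y∈Sλ : InSλ p (σ⁻¹y ⟨$⟩ʳ_)
    σ⁻¹y∈Sλ = preservesBlocks⇒InSλ p σ⁻¹y
      (preservesBlocks-∘ (preservesBlocks-inverse σ (InSλ⇒preservesBlocks σ∈Sλ)) (InSλ⇒preservesBlocks y∈Sλ))
    P-cases = P-at σ⁻¹y v σ⁻¹y∈Sλ v-minRep (cong (σ ⟨$⟩ˡ_) ∘ w≗yv)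
    Q-cases = Q-at y v y∈Sλ v-minRep w≗yv
    above : vk p q k ≤B (v ⟨$⟩ʳ_) → coeff (actP σ P) m ≡ coeff Q m
    above v≥vk = begin
      coeff (actP σ P) m                                       ≡⟨ coeff-actP σ P m ⟩
      coeff P (unpermuteMon σ m)                               ≡⟨ proj₁ P-cases v≥vk _ ⟩
      coeff (prodSk p q k h (σ⁻¹y ⟨$⟩ʳ_)) (unpermuteMon σ m)  ≡⟨ coeff-actP σ (prodSk p q k h (σ⁻¹y ⟨$⟩ʳ_)) m ⟨
      coeff (actP σ (prodSk p q k h (σ⁻¹y ⟨$⟩ʳ_))) m           ≡⟨ cong (λ z → coeff z m) (actP-prodSk σ (σ⁻¹y ⟨$⟩ʳ_)) ⟩
      coeff (prodSk p q k h (λ a → σ ⟨$⟩ʳ (σ⁻¹y ⟨$⟩ʳ a))) m    ≡⟨ cong (λ z → coeff z m) (prodSk-cong _ (y ⟨$⟩ʳ_) (λ _ → inverseʳ σ)) ⟩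
      coeff (prodSk p q k h (y ⟨$⟩ʳ_)) m                       ≡⟨ proj₁ Q-cases v≥vk m ⟨
      coeff Q m                                                ∎
    below : ¬ vk p q k ≤B (v ⟨$⟩ʳ_) → coeff (actP σ P) m ≡ coeff Q m
    below v≱vk = trans (coeff-actP σ P m) (trans (proj₂ P-cases v≱vk _) (sym (proj₂ Q-cases v≱vk m)))

  -- σ⁻¹ w = π v_k is already factorised, so f(σ⁻¹ w) is the nonzero product,
  -- whereas a broken pattern forces f(w) = 0.
  stabiliser-¬¬vkPattern : (σ : Permutation′ n) → StabFk p q k h σ → (π : Permutation′ n) → PreservesBlocks p (π ⟨$⟩ʳ_) →
                           ¬ ¬ VkPattern (λ x → σ ⟨$⟩ʳ (π ⟨$⟩ʳ vk p q k x))
  stabiliser-¬¬vkPattern σ stab π π-blocks ¬pattern =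
    prodSk-nonzero π (actP≈zero⇒≈zero σ (prodSk p q k h (π ⟨$⟩ʳ_)) (stab w (prodSk p q k h (π ⟨$⟩ʳ_)) zeroP at-σ⁻¹w at-w))
    where
    w = vkₚ ∘ₚ π ∘ₚ σ
    at-σ⁻¹w : fkVal p q k h (λ x → σ ⟨$⟩ˡ (w ⟨$⟩ʳ x)) (prodSk p q k h (π ⟨$⟩ʳ_))
    at-σ⁻¹w y v y∈Sλ v-minRep eq =
      (λ _ m → cong (λ z → coeff z m) (prodSk-cong (π ⟨$⟩ʳ_) (y ⟨$⟩ʳ_) (sym ∘ proj₁ unique))) ,
      (λ v≱vk → ⊥-elim (v≱vk (≤B-refl (sym ∘ proj₂ unique))))
      where
      unique = factorisation-unique p y π v vkₚ (InSλ⇒preservesBlocks y∈Sλ) π-blocks v-minRep vkₚ-minRep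
                 (λ x → trans (sym (eq x)) (inverseˡ σ))
    at-w : fkVal p q k h (w ⟨$⟩ʳ_) zeroP
    at-w y v y∈Sλ _ eq =
      (λ v≥vk → ⊥-elim (¬pattern (vkPattern-resp-≗ (sym ∘ eq)
        (vkPattern-preservesBlocks-∘ (InSλ⇒preservesBlocks y∈Sλ) (vkPattern-mono-≤B v≥vk vkPattern-vk))))) ,
      (λ _ _ → refl)

  PatternBreaker : Permutation′ n → Set
  PatternBreaker σ = ∃ λ (π : Permutation′ n) → PreservesBlocks p (π ⟨$⟩ʳ_) × ¬ VkPattern (λ x → σ ⟨$⟩ʳ (π ⟨$⟩ʳ vk p q k x))

  -- v_k sends position q + 1 to 1; π = (1 x) moves it to x, which σ sends past the first block.
  patternBreaker-2≤p : ∀ σ x → 2 ≤ p → toℕ x < p → p ≤ toℕ (σ ⟨$⟩ʳ x) → PatternBreaker σ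
  patternBreaker-2≤p σ x 2≤p x<p p≤σx = transpose one x , π-blocks , broken
    where
    1<n : 1 < n
    1<n = ℕP.≤-trans 2≤p (ℕP.m≤m+n p q)
    one = fromℕ< 1<n
    π-blocks : PreservesBlocks p (PC.transpose one x)
    π-blocks = transpose-preservesBlocks one x (inj₁ (subst (_< p) (sym (FP.toℕ-fromℕ< 1<n)) 2≤p , x<p))
    1+q<n : suc q < n
    1+q<n = ℕP.+-monoˡ-≤ q 2≤p
    pos : Fin n
    pos = fromℕ< 1+q<n
    vk-pos : vk p q k pos ≡ one
    vk-pos = FP.toℕ-injective (trans (toℕ-vk pos) (trans (cong (vkℕ p q k) (FP.toℕ-fromℕ< 1+q<n))
               (trans (vkℕ-tail p q k (suc q) k≤q (ℕP.n<1+n q)) (trans (ℕP.m+n∸n≡m 1 q) (sym (FP.toℕ-fromℕ< 1<n))))))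
    broken : ¬ VkPattern (λ y → σ ⟨$⟩ʳ PC.transpose one x (vk p q k y))
    broken (_ , late) = ℕP.<⇒≱ (subst (λ t → toℕ (σ ⟨$⟩ʳ t) < p)
                                      (trans (cong (PC.transpose one x) vk-pos) (transpose-matchˡ one x one refl))
                                      (late pos (subst (q <_) (sym (FP.toℕ-fromℕ< 1+q<n)) (ℕP.n<1+n q))))
                               p≤σx

  -- Here x = 0 and k ≥ 1, so v_k sends position 0 to p; π = (p c) with σ c = 0
  -- moves it to c, which lies in the second block because σ 0 ≠ 0.
  patternBreaker-p≡1 : ∀ σ x → p ≡ 1 → 1 ≤ k → 1 ≤ q → toℕ x < p → p ≤ toℕ (σ ⟨$⟩ʳ x) → PatternBreaker σ
  patternBreaker-p≡1 σ x p≡1 1≤k 1≤q x<p p≤σx = by-block-of-c (toℕ c <? p)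
    where
    0<n : 0 < n
    0<n = ℕP.≤-trans 1≤p (ℕP.m≤m+n p q)
    zero₀ : Fin n
    zero₀ = fromℕ< 0<n
    c : Fin n
    c = σ ⟨$⟩ˡ zero₀
    σc≡0 : toℕ (σ ⟨$⟩ʳ c) ≡ 0
    σc≡0 = trans (cong toℕ (inverseʳ σ)) (FP.toℕ-fromℕ< 0<n)
    p<n : p < n
    p<n = subst (_≤ n) (ℕP.+-comm p 1) (ℕP.+-monoʳ-≤ p 1≤q)
    pos : Fin n
    pos = fromℕ< p<n
    vk-0 : vk p q k zero₀ ≡ pos
    vk-0 = FP.toℕ-injective (trans (toℕ-vk zero₀) (trans (cong (vkℕ p q k) (FP.toℕ-fromℕ< 0<n))
             (trans (vkℕ-head p q k 0 1≤k) (trans (ℕP.+-identityʳ p) (sym (FP.toℕ-fromℕ< p<n))))))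
    by-block-of-c : Dec (toℕ c < p) → PatternBreaker σ
    by-block-of-c (yes c<p) = ⊥-elim (ℕP.<⇒≱ 1≤p (subst (p ≤_) σc≡0 (subst (λ t → p ≤ toℕ (σ ⟨$⟩ʳ t)) x≡c p≤σx)))
      where
      x≡c : x ≡ c
      x≡c = FP.toℕ-injective (trans (ℕP.n<1⇒n≡0 (subst (toℕ x <_) p≡1 x<p)) (sym (ℕP.n<1⇒n≡0 (subst (toℕ c <_) p≡1 c<p))))
    by-block-of-c (no c≮p) = transpose pos c , π-blocks , broken
      where
      π-blocks : PreservesBlocks p (PC.transpose pos c)
      π-blocks = transpose-preservesBlocks pos c (inj₂ (ℕP.≤-reflexive (sym (FP.toℕ-fromℕ< p<n)) , ℕP.≮⇒≥ c≮p))
      broken : ¬ VkPattern (λ y → σ ⟨$⟩ʳ PC.transpose pos c (vk p q k y))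
      broken (early , _) = ℕP.<⇒≱ 1≤p (subst (p ≤_) σc≡0 (subst (λ t → p ≤ toℕ (σ ⟨$⟩ʳ t))
        (trans (cong (PC.transpose pos c) vk-0) (transpose-matchˡ pos c pos refl))
        (early zero₀ (subst (_< k) (sym (FP.toℕ-fromℕ< 0<n)) 1≤k))))

  patternBreaker : ∀ σ x → (p ≡ 1 → 1 ≤ k) → 1 ≤ q → toℕ x < p → p ≤ toℕ (σ ⟨$⟩ʳ x) → PatternBreaker σ
  patternBreaker σ x p≡1⇒1≤k 1≤q x<p p≤σx with 2 ≤? p
  ... | yes 2≤p = patternBreaker-2≤p σ x 2≤p x<p p≤σx
  ... | no 2≰p = patternBreaker-p≡1 σ x p≡1 (p≡1⇒1≤k p≡1) 1≤q x<p p≤σx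
    where p≡1 = ℕP.≤-antisym (ℕP.≤-pred (ℕP.≰⇒> 2≰p)) 1≤p

  stabiliser⊆Sλ : (p ≡ 1 → 1 ≤ k) → 1 ≤ q → (σ : Permutation′ n) → StabFk p q k h σ → InSλ p (σ ⟨$⟩ʳ_)
  stabiliser⊆Sλ p≡1⇒1≤k 1≤q σ stab =
    preservesBlocks⇒InSλ p σ (preservesFirstBlock⇒preservesBlocks p σ (ℕP.m≤m+n p q) staysFirst)
    where
    staysFirst : ∀ x → toℕ x < p → toℕ (σ ⟨$⟩ʳ x) < p
    staysFirst x x<p = decidable-stable (toℕ (σ ⟨$⟩ʳ x) <? p) λ σx≮p →
      let π , π-blocks , broken = patternBreaker σ x p≡1⇒1≤k 1≤q x<p (ℕP.≮⇒≥ σx≮p)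
      in stabiliser-¬¬vkPattern σ stab π π-blocks broken

lemma4p11 : (p q : ℕ) → 1 ≤ p → 1 ≤ q →
    (h : Fin (p + q) → Fin (p + q)) → IsHessenberg h →
    (k : ℕ) → k ≤ q → (p ≡ 1 → 1 ≤ k) →
    (σ : Permutation′ (p + q)) →
    StabFk p q k h σ ⇔ InSλ p (σ ⟨$⟩ʳ_)
lemma4p11 p q 1≤p 1≤q h _ k k≤q p≡1⇒1≤k σ =
  mk⇔ (stabiliser⊆Sλ p≡1⇒1≤k 1≤q σ) (Sλ⊆stabiliser σ)
  where open Stabiliser p q k 1≤p k≤q h
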